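{- Let $r\ge 1$ be an integer. For every integer $n\ge 2$ and for each $\mathrm{O}\in\{\mathrm{Abs},\mathrm{Clr}\}$, $$P^{\mathrm{O}}_{G_{r,n}}(q,0,-1)=[r]_q\left(P^{\mathrm{O}}_{G_{r,n-1}}(q,0,-1)-q^{n-1}[r]_q^{\,n-1}\right),$$ and $P^{\mathrm{Abs}}_{G_{r,n}}(q,0,-1)=P^{\mathrm{Clr}}_{G_{r,n}}(q,0,-1)$. Consequently, $$P^{\mathrm{Abs}}_{G_{r,n}}(q,0,-1)=P^{\mathrm{Clr}}_{G_{r,n}}(q,0,-1)=-q\,[r]_q^{\,n}\,[n-1]_q .$$
   Context: $[m]_q=1+q+\cdots+q^{m-1}$ (with $[0]_q=0$). For positive integers $r,n$, $G_{r,n}=\mathbb{Z}_r\wr S_n$ is the set of pairs $\sigma=(z,\tau)$ with $z=(z_1,\dots,z_n)\in\{0,\dots,r-1\}^n$ and $\tau\in S_n$, with product $(z,\tau)(z',\tau')=((z_1+z'_{\tau(1)},\dots,z_n+z'_{\tau(n)}),\tau\circ\tau')$ (addition mod $r$). Write $z_i(\sigma)=z_i$ and $|\sigma|=\tau$. Statistics: $\mathrm{exc}(|\sigma|)=\#\{i\in[n]:\tau(i)>i\}$; $\mathrm{csum}(\sigma)=\sum_{i=1}^n z_i(\sigma)$ (as integers); $\mathrm{exc}_A(\sigma)=\#\{i\in[n-1]: z_i(\sigma)=0 \text{ and } \tau(i)>i\}$; $\mathrm{cyc}(\sigma)$ = number of cycles of $\tau$; $\mathrm{fix}(\sigma)=\#\{i\in[n]:\tau(i)=i\}$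 (number of absolute fixed points). Define $\mathrm{exc}^{\mathrm{Abs}}(\sigma)=\mathrm{exc}(|\sigma|)+\mathrm{csum}(\sigma)$ and $\mathrm{exc}^{\mathrm{Clr}}(\sigma)=r\cdot\mathrm{exc}_A(\sigma)+\mathrm{csum}(\sigma)$. For $\mathrm{O}\in\{\mathrm{Abs},\mathrm{Clr}\}$, $P^{\mathrm{O}}_{G_{r,n}}(q,t,s)=\sum_{\sigma\in G_{r,n}}q^{\mathrm{exc}^{\mathrm{O}}(\sigma)}t^{\mathrm{fix}(\sigma)}s^{\mathrm{cyc}(\sigma)}$, with the convention $0^0=1$; thus $P^{\mathrm{O}}_{G_{r,n}}(q,0,-1)$ is the sum of $q^{\mathrm{exc}^{\mathrm{O}}(\sigma)}(-1)^{\mathrm{cyc}(\sigma)}$ over the derangements $\sigma$ (those with $\tau(i)\neq i$ for all $i$). -}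

module Defs where

open import Data.Nat as ℕ using (ℕ; zero; suc; _<ᵇ_; _≤ᵇ_; _∸_)
open import Data.Integer as ℤ using (ℤ; +_; -_; _-_)
open import Data.Fin as Fin using (Fin; zero; suc; toℕ; _≟_)
open import Data.List using (List; []; _∷_; map; concatMap; allFin)
open import Data.Bool using (Bool; true; false; if_then_else_; _∧_; _∨_; not)
open import Relation.Nullary.Decidable using (⌊_⌋)

allB : {A : Set} → (A → Bool) → List A → Bool
allB p []       = true
allB p (x ∷ xs) = p x ∧ allB p xs

sumL : {A : Set} → List A → (A → ℤ) → ℤ
sumL []       f = + 0
sumL (x ∷ xs) f = f x ℤ.+ sumL xs f

count : {n : ℕ} → (Fin n → Bool) → ℕ
count {n} p = go (allFin n)
  where
  go : List (Fin n) → ℕ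
  go []       = 0
  go (i ∷ is) = (if p i then 1 else 0) ℕ.+ go is

cons : {n m : ℕ} → Fin m → (Fin n → Fin m) → Fin (suc n) → Fin m
cons a f zero    = a
cons a f (suc i) = f i

allFuns : (n m : ℕ) → List (Fin n → Fin m)
allFuns zero    m = (λ ()) ∷ []
allFuns (suc n) m = concatMap (λ f → map (λ a → cons a f) (allFin m)) (allFuns n m)

-- τ : Fin n → Fin n is a permutation (i.e. injective, hence bijective)
isPerm : {n : ℕ} → (Fin n → Fin n) → Bool
isPerm {n} τ = allB (λ i → allB (λ j → not ⌊ τ i ≟ τ j ⌋ ∨ ⌊ i ≟ j ⌋) (allFin n)) (allFin n)

qint : ℕ → ℤ → ℤ
qint zero    q = + 0
qint (suc m) q = qint m q ℤ.+ q ℤ.^ m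

iter : {n : ℕ} → (Fin n → Fin n) → ℕ → Fin n → Fin n
iter τ zero    i = i
iter τ (suc k) i = τ (iter τ k i)

-- Elements of G_{r,n}: colour vector z and underlying permutation τ
-- (τ is required to be a permutation, see isPerm)
module _ {r n : ℕ} (z : Fin n → Fin r) (τ : Fin n → Fin n) where

  exc : ℕ
  exc = count (λ i → toℕ i <ᵇ toℕ (τ i))

  csum : ℕ
  csum = go (allFin n)
    where
    go : List (Fin n) → ℕ
    go []       = 0
    go (i ∷ is) = toℕ (z i) ℕ.+ go is

  -- exc_A(σ) = #{ i ∈ [n-1] : z_i = 0 and τ(i) > i }
  -- (Fin index i corresponds to the integer i+1, so i+1 ∈ [n-1] iff toℕ i + 1 < n)
  excA : ℕ
  excA = count (λ i → (suc (toℕ i) <ᵇ n) ∧ (toℕ (z i) ℕ.≡ᵇ 0) ∧ (toℕ i <ᵇ toℕ (τ i)))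

  fix : ℕ
  fix = count (λ i → ⌊ τ i ≟ i ⌋)

  -- cyc(σ) = number of cycles of τ, counted as the number of elements which are
  -- the minimum of their cycle (orbit {τ^k(i) : k < n})
  cyc : ℕ
  cyc = count (λ i → allB (λ k → toℕ i ≤ᵇ toℕ (iter τ (toℕ k) i)) (allFin n))

data Stat : Set where
  Abs Clr : Stat

excO : Stat → (r : ℕ) → {n : ℕ} → (Fin n → Fin r) → (Fin n → Fin n) → ℕ
excO Abs r z τ = exc z τ ℕ.+ csum z τ
excO Clr r z τ = r ℕ.* excA z τ ℕ.+ csum z τ

-- P^O_{G_{r,n}}(q,t,s) = Σ_{σ ∈ G_{r,n}} q^{exc^O σ} t^{fix σ} s^{cyc σ}  (x^0 = 1)
P : Stat → (r n : ℕ) → (q t s : ℤ) → ℤ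
P O r n q t s =
  sumL (allFuns n r) λ z →
  sumL (allFuns n n) λ τ →
    if isPerm τ
    then q ℤ.^ excO O r z τ ℤ.* t ℤ.^ fix z τ ℤ.* s ℤ.^ cyc z τ
    else + 0

-- Summing out the colours gives a factor [r]_q per position: for exc^Abs this is
-- ∑_a q^a, and for exc^Clr the extra weight r of an excedance sits on colour 0
-- only, where q^r + q + ⋯ + q^(r-1) = q [r]_q.  So P^O_{G_{r,n}} = [r]_q^n P_{S_n}.
-- Every permutation of {0, …, n} arises exactly once from a permutation of
-- {0, …, n-1} by inserting n right after some j in its cycle, or as a new fixed
-- point; whether j is an excedance, a fixed point or neither determines how
-- (exc, fix, cyc) change.  Hence the coefficients of q^e t^f in
-- ∑_τ q^exc t^fix (-1)^cyc obey a linear recursion in n, which is also solved by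
-- (-1)^f (n choose f) d_{n-f}(e) with ∑_e d_m(e) q^e = -q [m-1]_q for m ≥ 1.
-- At t = 0 this gives P_{S_n}(q,0,-1) = -q [n-1]_q.

module Submission where

open import Defs
open import Data.Nat using (ℕ; _≤_; _∸_)
open import Data.Integer using (ℤ; +_; -_; _-_; _*_; _^_)
open import Data.Product using (_×_)
open import Relation.Binary.PropositionalEquality using (_≡_)

open import Data.Nat as ℕ using (zero; suc; pred; _<ᵇ_; _≤ᵇ_; _<_; z≤n; s≤s)
import Data.Nat.Properties as ℕP
open import Data.Integer using (_+_)
import Data.Integer.Properties as ℤP
open import Data.Fin as Fin using (Fin; zero; suc; toℕ; fromℕ; fromℕ<; inject₁; _≟_; punchIn; punchOut)
import Data.Fin.Properties as FinP
open import Data.Fin.Relation.Unary.Top using (View; view; ‵fromℕ; ‵inject₁; view-fromℕ; view-inject₁)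
open import Data.Fin.Permutation.Components using (transpose; transpose-inverse)
open import Data.List using (List; []; _∷_; _++_; map; concatMap; foldr; allFin; tabulate)
open import Data.List.Properties using (foldr-universal)
open import Data.List.Relation.Unary.Any using (here; there)
open import Data.List.Membership.Propositional using (_∈_)
open import Data.List.Membership.Propositional.Properties using (∈-allFin)
open import Data.Bool using (Bool; true; false; if_then_else_; _∧_; _∨_; not)
open import Data.Bool.Properties using (T-≡; ∧-zeroʳ)
open import Data.Product using (∃; _,_; proj₁; proj₂)
open import Data.Sum using (_⊎_; inj₁; inj₂)
open import Function using (_∘_; id)
open import Function.Bundles using (Equivalence)
open import Function.Definitions using (Injective)
open import Relation.Binary using (tri<; tri≈; tri>)
open import Relation.Binary.PropositionalEquality
open import Relation.Nullary using (Dec; does; yes; no)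
open import Relation.Nullary.Decidable as Dec using (⌊_⌋; isYes≗does; _×-dec_; dec-true; dec-false)
open import Relation.Nullary.Negation using (contradiction)
open import Algebra.Properties.CommutativeSemigroup ℕP.+-commutativeSemigroup using (xy∙z≈zy∙x; xy∙z≈xz∙y)
open import Data.Integer.Solver using (module +-*-Solver)
open +-*-Solver using (solve; _:+_; _:*_; _:-_; :-_; _:=_; con)

open import Algebra.Properties.Semiring.Sum ℤP.+-*-semiring
  using (sum; sum-syntax; sum-cong-≗; sum-init-last; sum-replicate-zero; ∑-distrib-+; *-distribˡ-sum; *-distribʳ-sum)
import Algebra.Properties.Semiring.Sum as SemiringSum
module ℕΣ = SemiringSum ℕP.+-*-semiring

𝟙 : Bool → ℤ
𝟙 true  = + 1
𝟙 false = + 0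

𝟙ℕ : Bool → ℕ
𝟙ℕ b = if b then 1 else 0

if-zero : (b : Bool) (x : ℤ) → (if b then x else + 0) ≡ 𝟙 b * x
if-zero true  x = sym (ℤP.*-identityˡ x)
if-zero false x = refl

𝟙-∧ : (a b : Bool) → 𝟙 (a ∧ b) ≡ 𝟙 a * 𝟙 b
𝟙-∧ true  b = sym (ℤP.*-identityˡ (𝟙 b))
𝟙-∧ false b = refl

𝟙≡+𝟙ℕ : (b : Bool) → 𝟙 b ≡ + 𝟙ℕ b
𝟙≡+𝟙ℕ true  = refl
𝟙≡+𝟙ℕ false = refl

bool-ext : {a b : Bool} → (a ≡ true → b ≡ true) → (b ≡ true → a ≡ true) → a ≡ b
bool-ext {false} {false} _ _ = refl
bool-ext {false} {true}  _ b⇒a = b⇒a refl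
bool-ext {true}  a⇒b _ = sym (a⇒b refl)

<ᵇ-true : {m n : ℕ} → m ℕ.< n → (m <ᵇ n) ≡ true
<ᵇ-true m<n = Equivalence.to T-≡ (ℕP.<⇒<ᵇ m<n)

<ᵇ-true⁻¹ : {m n : ℕ} → (m <ᵇ n) ≡ true → m ℕ.< n
<ᵇ-true⁻¹ {m} {n} e = ℕP.<ᵇ⇒< m n (Equivalence.from T-≡ e)

≤ᵇ-true : {m n : ℕ} → m ℕ.≤ n → (m ≤ᵇ n) ≡ true
≤ᵇ-true m≤n = Equivalence.to T-≡ (ℕP.≤⇒≤ᵇ m≤n)

≤ᵇ-true⁻¹ : {m n : ℕ} → (m ≤ᵇ n) ≡ true → m ℕ.≤ n
≤ᵇ-true⁻¹ {m} {n} e = ℕP.≤ᵇ⇒≤ m n (Equivalence.from T-≡ e)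

≡ᵇ-true⁻¹ : {m n : ℕ} → (m ℕ.≡ᵇ n) ≡ true → m ≡ n
≡ᵇ-true⁻¹ {m} {n} e = ℕP.≡ᵇ⇒≡ m n (Equivalence.from T-≡ e)

<ᵇ-false : {m n : ℕ} → n ℕ.≤ m → (m <ᵇ n) ≡ false
<ᵇ-false {m} {n} n≤m with m <ᵇ n in e
... | true  = contradiction n≤m (ℕP.<⇒≱ (<ᵇ-true⁻¹ e))
... | false = refl

⌊≟⌋-injective : {m n : ℕ} {g : Fin m → Fin n} → Injective _≡_ _≡_ g → (a b : Fin m) → ⌊ g a ≟ g b ⌋ ≡ ⌊ a ≟ b ⌋
⌊≟⌋-injective {g = g} g-inj a b with g a ≟ g b | a ≟ b
... | yes _     | yes _   = refl
... | no _      | no _    = refl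
... | yes ga≡gb | no a≢b  = contradiction (g-inj ga≡gb) a≢b
... | no ga≢gb  | yes a≡b = contradiction (cong g a≡b) ga≢gb

⌊≟⌋-false : {n : ℕ} {a b : Fin n} → a ≢ b → ⌊ a ≟ b ⌋ ≡ false
⌊≟⌋-false {a = a} {b} a≢b = trans (isYes≗does (a ≟ b)) (dec-false (a ≟ b) a≢b)

⌊≟⌋-refl : {n : ℕ} (a : Fin n) → ⌊ a ≟ a ⌋ ≡ true
⌊≟⌋-refl a = trans (isYes≗does (a ≟ a)) (dec-true (a ≟ a) refl)

∑-sift : {m : ℕ} (b : Fin m) (h : Fin m → ℤ) → ∑[ a < m ] (𝟙 (does (a ≟ b)) * h a) ≡ h b
∑-sift {suc m} zero h = begin
  + 1 * h zero + ∑[ a < m ] (+ 0 * h (suc a))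
    ≡⟨ cong₂ _+_ (ℤP.*-identityˡ (h zero)) (trans (sum-cong-≗ (ℤP.*-zeroˡ ∘ h ∘ suc)) (sum-replicate-zero m)) ⟩
  h zero + + 0
    ≡⟨ ℤP.+-identityʳ (h zero) ⟩
  h zero ∎
  where open ≡-Reasoning
∑-sift {suc m} (suc b) h = trans (ℤP.+-identityˡ _) (∑-sift b (h ∘ suc))

∑-sift-toℕ : {n : ℕ} (h : ℕ → ℤ) {x : ℕ} → x < n → ∑[ e < n ] (𝟙 (toℕ e ℕ.≡ᵇ x) * h (toℕ e)) ≡ h x
∑-sift-toℕ {suc n} h {zero} _ = begin
  + 1 * h 0 + ∑[ e < n ] (+ 0 * h (suc (toℕ e)))  ≡⟨ cong₂ _+_ (ℤP.*-identityˡ (h 0)) (sum-replicate-zero n) ⟩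
  h 0 + + 0                                      ≡⟨ ℤP.+-identityʳ (h 0) ⟩
  h 0                                            ∎
  where open ≡-Reasoning
∑-sift-toℕ {suc n} h {suc x} (s≤s x<n) = trans (ℤP.+-identityˡ _) (∑-sift-toℕ (h ∘ suc) x<n)

module _ {A : Set} where

  sumL-cong : (l : List A) {f g : A → ℤ} → (∀ x → f x ≡ g x) → sumL l f ≡ sumL l g
  sumL-cong []      e = refl
  sumL-cong (x ∷ l) e = cong₂ _+_ (e x) (sumL-cong l e)

  sumL-zero : (l : List A) → sumL l (λ _ → + 0) ≡ + 0
  sumL-zero []      = refl
  sumL-zero (x ∷ l) = trans (ℤP.+-identityˡ _) (sumL-zero l)

  sumL-++ : (l l′ : List A) (f : A → ℤ) → sumL (l ++ l′) f ≡ sumL l f + sumL l′ f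
  sumL-++ []      l′ f = sym (ℤP.+-identityˡ _)
  sumL-++ (x ∷ l) l′ f = trans (cong (_+_ (f x)) (sumL-++ l l′ f)) (sym (ℤP.+-assoc (f x) _ _))

  sumL-*ˡ : (l : List A) (c : ℤ) (f : A → ℤ) → sumL l (λ x → c * f x) ≡ c * sumL l f
  sumL-*ˡ []      c f = sym (ℤP.*-zeroʳ c)
  sumL-*ˡ (x ∷ l) c f = trans (cong (_+_ (c * f x)) (sumL-*ˡ l c f)) (sym (ℤP.*-distribˡ-+ c (f x) _))

  sumL-*ʳ : (l : List A) (c : ℤ) (f : A → ℤ) → sumL l (λ x → f x * c) ≡ sumL l f * c
  sumL-*ʳ l c f = trans (sumL-cong l (λ x → ℤP.*-comm (f x) c)) (trans (sumL-*ˡ l c f) (ℤP.*-comm c _))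

  sumL-+ : (l : List A) (f g : A → ℤ) → sumL l (λ x → f x + g x) ≡ sumL l f + sumL l g
  sumL-+ []      f g = refl
  sumL-+ (x ∷ l) f g = trans (cong (_+_ (f x + g x)) (sumL-+ l f g))
    (solve 4 (λ a b c d → (a :+ b) :+ (c :+ d) := (a :+ c) :+ (b :+ d)) refl (f x) (g x) (sumL l f) (sumL l g))

  sumL-∑-comm : (l : List A) {n : ℕ} (f : A → Fin n → ℤ) →
                sumL l (λ x → ∑[ i < n ] f x i) ≡ ∑[ i < n ] sumL l (λ x → f x i)
  sumL-∑-comm []      {n} f = sym (sum-replicate-zero n)
  sumL-∑-comm (x ∷ l)     f = trans (cong (_+_ (sum (f x))) (sumL-∑-comm l f)) (sym (∑-distrib-+ (f x) _))

module _ {A B : Set} where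

  sumL-comm : (l : List A) (l′ : List B) (f : A → B → ℤ) →
              sumL l (λ x → sumL l′ (f x)) ≡ sumL l′ (λ y → sumL l (λ x → f x y))
  sumL-comm []      l′ f = sym (sumL-zero l′)
  sumL-comm (x ∷ l) l′ f = trans (cong (_+_ (sumL l′ (f x))) (sumL-comm l l′ f)) (sym (sumL-+ l′ (f x) _))

  sumL-map : (h : A → B) (l : List A) (f : B → ℤ) → sumL (map h l) f ≡ sumL l (f ∘ h)
  sumL-map h []      f = refl
  sumL-map h (x ∷ l) f = cong (_+_ (f (h x))) (sumL-map h l f)

  sumL-concatMap : (g : A → List B) (l : List A) (f : B → ℤ) →
                   sumL (concatMap g l) f ≡ sumL l (λ x → sumL (g x) f)
  sumL-concatMap g []      f = refl
  sumL-concatMap g (x ∷ l) f = trans (sumL-++ (g x) (concatMap g l) f) (cong (_+_ (sumL (g x) f)) (sumL-concatMap g l f))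

sumL-tabulate : {A : Set} {n : ℕ} (g : Fin n → A) (f : A → ℤ) → sumL (tabulate g) f ≡ ∑[ i < n ] f (g i)
sumL-tabulate {n = zero}  g f = refl
sumL-tabulate {n = suc n} g f = cong (_+_ (f (g zero))) (sumL-tabulate (g ∘ suc) f)

sumL-allFin : (n : ℕ) (f : Fin n → ℤ) → sumL (allFin n) f ≡ ∑[ i < n ] f i
sumL-allFin n = sumL-tabulate id

sumL-allFuns-suc : (n m : ℕ) (F : (Fin (suc n) → Fin m) → ℤ) →
                   sumL (allFuns (suc n) m) F ≡ sumL (allFuns n m) (λ f → ∑[ a < m ] F (cons a f))
sumL-allFuns-suc n m F = trans (sumL-concatMap _ (allFuns n m) F) (sumL-cong (allFuns n m) λ f →
  trans (sumL-map (λ a → cons a f) (allFin m) F) (sumL-allFin m (λ a → F (cons a f))))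

infix 4 _≗?_

_≗?_ : {n m : ℕ} (f g : Fin n → Fin m) → Dec (f ≗ g)

_≗?_ {zero}  f g = yes (λ ())
_≗?_ {suc n} f g = Dec.map (FinP.∀-cons-⇔ {P = λ i → f i ≡ g i}) (f zero ≟ g zero ×-dec (f ∘ suc ≗? g ∘ suc))

Respects≗ : {n m : ℕ} → ((Fin n → Fin m) → ℤ) → Set
Respects≗ h = ∀ {f g} → f ≗ g → h f ≡ h g

allFuns-sift : (n m : ℕ) (h : (Fin n → Fin m) → ℤ) → Respects≗ h → (f : Fin n → Fin m) →
               sumL (allFuns n m) (λ g → 𝟙 (does (g ≗? f)) * h g) ≡ h f
allFuns-sift zero m h resp f = trans (ℤP.+-identityʳ _) (trans (ℤP.*-identityˡ _) (resp (λ ())))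
allFuns-sift (suc n) m h resp f = begin
  sumL (allFuns (suc n) m) (λ g → 𝟙 (does (g ≗? f)) * h g)
    ≡⟨ sumL-allFuns-suc n m _ ⟩
  sumL (allFuns n m) (λ g → ∑[ a < m ] (𝟙 (does (a ≟ f zero) ∧ does (g ≗? f ∘ suc)) * h (cons a g)))
    ≡⟨ sumL-cong (allFuns n m) sift-head ⟩
  sumL (allFuns n m) (λ g → 𝟙 (does (g ≗? f ∘ suc)) * h (cons (f zero) g))
    ≡⟨ allFuns-sift n m (h ∘ cons (f zero)) (λ e → resp (FinP.∀-cons refl e)) (f ∘ suc) ⟩
  h (cons (f zero) (f ∘ suc))
    ≡⟨ resp (FinP.∀-cons refl (λ _ → refl)) ⟩
  h f ∎
  where
  open ≡-Reasoning
  sift-head : ∀ g → ∑[ a < m ] (𝟙 (does (a ≟ f zero) ∧ does (g ≗? f ∘ suc)) * h (cons a g))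
                  ≡ 𝟙 (does (g ≗? f ∘ suc)) * h (cons (f zero) g)
  sift-head g = begin
    ∑[ a < m ] (𝟙 (does (a ≟ f zero) ∧ δ) * h (cons a g))
      ≡⟨ sum-cong-≗ {m} (λ a → reorder (does (a ≟ f zero)) (h (cons a g))) ⟩
    ∑[ a < m ] (𝟙 δ * (𝟙 (does (a ≟ f zero)) * h (cons a g)))
      ≡⟨ *-distribˡ-sum (𝟙 δ) (λ a → 𝟙 (does (a ≟ f zero)) * h (cons a g)) ⟨
    𝟙 δ * ∑[ a < m ] (𝟙 (does (a ≟ f zero)) * h (cons a g))
      ≡⟨ cong (𝟙 δ *_) (∑-sift (f zero) (λ a → h (cons a g))) ⟩
    𝟙 δ * h (cons (f zero) g) ∎
    where
    δ = does (g ≗? f ∘ suc)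
    reorder : ∀ b x → 𝟙 (b ∧ δ) * x ≡ 𝟙 δ * (𝟙 b * x)
    reorder b x = trans (cong (_* x) (𝟙-∧ b δ)) (solve 3 (λ u v w → (u :* v) :* w := v :* (u :* w)) refl (𝟙 b) (𝟙 δ) x)

foldr-allFin : (n : ℕ) (g : Fin n → ℕ) → foldr (λ i k → g i ℕ.+ k) 0 (allFin n) ≡ ℕΣ.sum g
foldr-allFin n g = go n id
  where
  go : (m : ℕ) (h : Fin m → Fin n) → foldr (λ i k → g i ℕ.+ k) 0 (tabulate h) ≡ ℕΣ.sum (g ∘ h)
  go zero    h = refl
  go (suc m) h = cong (g (h zero) ℕ.+_) (go m (h ∘ suc))

-- Defs computes `count` and `csum` by a local recursion over `allFin n`;
-- abstracting `allFin n` lets `foldr-universal` identify it with a fold.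
count≡sum : {n : ℕ} (p : Fin n → Bool) → count p ≡ ℕΣ.sum (𝟙ℕ ∘ p)
count≡sum {n} p = trans as-foldr (foldr-allFin n _)
  where
  as-foldr : count p ≡ foldr (λ i k → 𝟙ℕ (p i) ℕ.+ k) 0 (allFin n)
  as-foldr with allFin n | foldr-universal _ (λ i k → 𝟙ℕ (p i) ℕ.+ k) 0 refl (λ _ _ → refl)
  ... | is | universal = universal is

csum≡sum : {r n : ℕ} (z : Fin n → Fin r) (τ : Fin n → Fin n) → csum z τ ≡ ℕΣ.sum (toℕ ∘ z)
csum≡sum {n = n} z τ = trans as-foldr (foldr-allFin n _)
  where
  as-foldr : csum z τ ≡ foldr (λ i k → toℕ (z i) ℕ.+ k) 0 (allFin n)
  as-foldr with allFin n | foldr-universal _ (λ i k → toℕ (z i) ℕ.+ k) 0 refl (λ _ _ → refl)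
  ... | is | universal = universal is

∑-𝟙* : {n : ℕ} (p : Fin n → Bool) (X : ℤ) → ∑[ k < n ] (𝟙 (p k) * X) ≡ + count p * X
∑-𝟙* {n} p X = trans (as-ℕ n p) (cong (λ c → + c * X) (sym (count≡sum p)))
  where
  as-ℕ : ∀ m (p : Fin m → Bool) → ∑[ k < m ] (𝟙 (p k) * X) ≡ + ℕΣ.sum (𝟙ℕ ∘ p) * X
  as-ℕ zero    p = sym (ℤP.*-zeroˡ X)
  as-ℕ (suc m) p = begin
    𝟙 (p zero) * X + ∑[ k < m ] (𝟙 (p (suc k)) * X)      ≡⟨ cong₂ _+_ (cong (_* X) (𝟙≡+𝟙ℕ (p zero))) (as-ℕ m (p ∘ suc)) ⟩
    + 𝟙ℕ (p zero) * X + + ℕΣ.sum (𝟙ℕ ∘ p ∘ suc) * X    ≡⟨ ℤP.*-distribʳ-+ X (+ 𝟙ℕ (p zero)) (+ ℕΣ.sum (𝟙ℕ ∘ p ∘ suc)) ⟨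
    (+ 𝟙ℕ (p zero) + + ℕΣ.sum (𝟙ℕ ∘ p ∘ suc)) * X      ≡⟨ cong (_* X) (ℤP.pos-+ (𝟙ℕ (p zero)) (ℕΣ.sum (𝟙ℕ ∘ p ∘ suc))) ⟨
    + ℕΣ.sum (𝟙ℕ ∘ p) * X                             ∎
    where open ≡-Reasoning

module _ {n : ℕ} where

  count-cong : {p p′ : Fin n → Bool} → (∀ i → p i ≡ p′ i) → count p ≡ count p′
  count-cong {p} {p′} e = trans (count≡sum p) (trans (ℕΣ.sum-cong-≗ (cong 𝟙ℕ ∘ e)) (sym (count≡sum p′)))

  count≤n : (p : Fin n → Bool) → count p ≤ n
  count≤n p = subst (_≤ n) (sym (count≡sum p)) (bounded n (𝟙ℕ ∘ p) (λ i → bit (p i)))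
    where
    bit : ∀ b → 𝟙ℕ b ≤ 1
    bit true  = ℕP.≤-refl
    bit false = z≤n
    bounded : ∀ m (g : Fin m → ℕ) → (∀ i → g i ≤ 1) → ℕΣ.sum g ≤ m
    bounded zero    g g≤1 = z≤n
    bounded (suc m) g g≤1 = ℕP.+-mono-≤ (g≤1 zero) (bounded m (g ∘ suc) (g≤1 ∘ suc))

count-init-last : {n : ℕ} (p : Fin (suc n) → Bool) → count p ≡ count (p ∘ inject₁) ℕ.+ 𝟙ℕ (p (fromℕ n))
count-init-last {n} p = trans (count≡sum p) (trans (ℕΣ.sum-init-last {n} (𝟙ℕ ∘ p)) (cong (ℕ._+ 𝟙ℕ (p (fromℕ n))) (sym (count≡sum (p ∘ inject₁)))))

count-update : {n : ℕ} (p p′ : Fin n → Bool) (k : Fin n) → (∀ i → i ≢ k → p′ i ≡ p i) →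
               count p′ ℕ.+ 𝟙ℕ (p k) ≡ count p ℕ.+ 𝟙ℕ (p′ k)
count-update {suc n} p p′ k same = begin
  count p′ ℕ.+ 𝟙ℕ (p k)
    ≡⟨ cong (ℕ._+ 𝟙ℕ (p k)) (trans (count≡sum p′) (ℕΣ.sum-remove {i = k} (𝟙ℕ ∘ p′))) ⟩
  𝟙ℕ (p′ k) ℕ.+ rest p′ ℕ.+ 𝟙ℕ (p k)
    ≡⟨ cong (λ s → 𝟙ℕ (p′ k) ℕ.+ s ℕ.+ 𝟙ℕ (p k)) (ℕΣ.sum-cong-≗ away) ⟩
  𝟙ℕ (p′ k) ℕ.+ rest p ℕ.+ 𝟙ℕ (p k)
    ≡⟨ xy∙z≈zy∙x (𝟙ℕ (p′ k)) (rest p) (𝟙ℕ (p k)) ⟩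
  𝟙ℕ (p k) ℕ.+ rest p ℕ.+ 𝟙ℕ (p′ k)
    ≡⟨ cong (ℕ._+ 𝟙ℕ (p′ k)) (trans (count≡sum p) (ℕΣ.sum-remove {i = k} (𝟙ℕ ∘ p))) ⟨
  count p ℕ.+ 𝟙ℕ (p′ k) ∎
  where
  open ≡-Reasoning
  rest : (Fin (suc n) → Bool) → ℕ
  rest q = ℕΣ.sum (λ i → 𝟙ℕ (q (punchIn k i)))
  away : ∀ i → 𝟙ℕ (p′ (punchIn k i)) ≡ 𝟙ℕ (p (punchIn k i))
  away i = cong 𝟙ℕ (same (punchIn k i) (FinP.punchInᵢ≢i k i))

module _ {n : ℕ} (p : Fin (suc n) → Bool) (p′ : Fin n → Bool) where

  count-lift : (∀ x → p (inject₁ x) ≡ p′ x) → count p ≡ count p′ ℕ.+ 𝟙ℕ (p (fromℕ n))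
  count-lift same = trans (count-init-last p) (cong (ℕ._+ 𝟙ℕ (p (fromℕ n))) (count-cong same))

  count-lift-except : (k : Fin n) → (∀ x → x ≢ k → p (inject₁ x) ≡ p′ x) →
                      count p ℕ.+ 𝟙ℕ (p′ k) ≡ count p′ ℕ.+ 𝟙ℕ (p (inject₁ k)) ℕ.+ 𝟙ℕ (p (fromℕ n))
  count-lift-except k same = begin
    count p ℕ.+ 𝟙ℕ (p′ k)
      ≡⟨ cong (ℕ._+ 𝟙ℕ (p′ k)) (count-init-last p) ⟩
    count (p ∘ inject₁) ℕ.+ 𝟙ℕ (p (fromℕ n)) ℕ.+ 𝟙ℕ (p′ k)
      ≡⟨ xy∙z≈xz∙y (count (p ∘ inject₁)) (𝟙ℕ (p (fromℕ n))) (𝟙ℕ (p′ k)) ⟩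
    count (p ∘ inject₁) ℕ.+ 𝟙ℕ (p′ k) ℕ.+ 𝟙ℕ (p (fromℕ n))
      ≡⟨ cong (ℕ._+ 𝟙ℕ (p (fromℕ n))) (count-update p′ (p ∘ inject₁) k same) ⟩
    count p′ ℕ.+ 𝟙ℕ (p (inject₁ k)) ℕ.+ 𝟙ℕ (p (fromℕ n)) ∎
    where open ≡-Reasoning

count-partition : {n : ℕ} (p q r : Fin n → Bool) → (∀ i → 𝟙ℕ (p i) ℕ.+ 𝟙ℕ (q i) ℕ.+ 𝟙ℕ (r i) ≡ 1) →
                  count p ℕ.+ count q ℕ.+ count r ≡ n
count-partition {n} p q r one = begin
  count p ℕ.+ count q ℕ.+ count r
    ≡⟨ cong₂ ℕ._+_ (cong₂ ℕ._+_ (count≡sum p) (count≡sum q)) (count≡sum r) ⟩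
  ℕΣ.sum (𝟙ℕ ∘ p) ℕ.+ ℕΣ.sum (𝟙ℕ ∘ q) ℕ.+ ℕΣ.sum (𝟙ℕ ∘ r)
    ≡⟨ cong (ℕ._+ ℕΣ.sum (𝟙ℕ ∘ r)) (ℕΣ.∑-distrib-+ (𝟙ℕ ∘ p) (𝟙ℕ ∘ q)) ⟨
  ℕΣ.sum (λ i → 𝟙ℕ (p i) ℕ.+ 𝟙ℕ (q i)) ℕ.+ ℕΣ.sum (𝟙ℕ ∘ r)
    ≡⟨ ℕΣ.∑-distrib-+ (λ i → 𝟙ℕ (p i) ℕ.+ 𝟙ℕ (q i)) (𝟙ℕ ∘ r) ⟨
  ℕΣ.sum (λ i → 𝟙ℕ (p i) ℕ.+ 𝟙ℕ (q i) ℕ.+ 𝟙ℕ (r i))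
    ≡⟨ ℕΣ.sum-cong-≗ one ⟩
  ℕΣ.sum {n} (λ _ → 1)
    ≡⟨ ones n ⟩
  n ∎
  where
  open ≡-Reasoning
  ones : ∀ m → ℕΣ.sum {m} (λ _ → 1) ≡ m
  ones zero    = refl
  ones (suc m) = cong suc (ones m)

sumPerm : (n : ℕ) → ((Fin n → Fin n) → ℤ) → ℤ
sumPerm n F = sumL (allFuns n n) (λ τ → if isPerm τ then F τ else + 0)

module _ (n : ℕ) where

  sumPerm-as-sumL : (F : (Fin n → Fin n) → ℤ) → sumPerm n F ≡ sumL (allFuns n n) (λ τ → 𝟙 (isPerm τ) * F τ)
  sumPerm-as-sumL F = sumL-cong (allFuns n n) (λ τ → if-zero (isPerm τ) (F τ))

  sumPerm-cong : {F G : (Fin n → Fin n) → ℤ} → (∀ τ → isPerm τ ≡ true → F τ ≡ G τ) → sumPerm n F ≡ sumPerm n G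
  sumPerm-cong {F} {G} e = sumL-cong (allFuns n n) on-perm
    where
    on-perm : ∀ τ → (if isPerm τ then F τ else + 0) ≡ (if isPerm τ then G τ else + 0)
    on-perm τ with isPerm τ in p
    ... | true  = e τ p
    ... | false = refl

  sumPerm-*ˡ : (c : ℤ) (F : (Fin n → Fin n) → ℤ) → sumPerm n (λ τ → c * F τ) ≡ c * sumPerm n F
  sumPerm-*ˡ c F = begin
    sumPerm n (λ τ → c * F τ)
      ≡⟨ sumPerm-as-sumL _ ⟩
    sumL (allFuns n n) (λ τ → 𝟙 (isPerm τ) * (c * F τ))
      ≡⟨ sumL-cong (allFuns n n) (λ τ → solve 3 (λ x y z → x :* (y :* z) := y :* (x :* z)) refl (𝟙 (isPerm τ)) c (F τ)) ⟩
    sumL (allFuns n n) (λ τ → c * (𝟙 (isPerm τ) * F τ))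
      ≡⟨ sumL-*ˡ (allFuns n n) c _ ⟩
    c * sumL (allFuns n n) (λ τ → 𝟙 (isPerm τ) * F τ)
      ≡⟨ cong (c *_) (sumPerm-as-sumL F) ⟨
    c * sumPerm n F ∎
    where open ≡-Reasoning

  sumPerm-+ : (F G : (Fin n → Fin n) → ℤ) → sumPerm n (λ τ → F τ + G τ) ≡ sumPerm n F + sumPerm n G
  sumPerm-+ F G = begin
    sumPerm n (λ τ → F τ + G τ)
      ≡⟨ sumPerm-as-sumL _ ⟩
    sumL (allFuns n n) (λ τ → 𝟙 (isPerm τ) * (F τ + G τ))
      ≡⟨ sumL-cong (allFuns n n) (λ τ → ℤP.*-distribˡ-+ (𝟙 (isPerm τ)) (F τ) (G τ)) ⟩
    sumL (allFuns n n) (λ τ → 𝟙 (isPerm τ) * F τ + 𝟙 (isPerm τ) * G τ)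
      ≡⟨ sumL-+ (allFuns n n) (λ τ → 𝟙 (isPerm τ) * F τ) (λ τ → 𝟙 (isPerm τ) * G τ) ⟩
    sumL (allFuns n n) (λ τ → 𝟙 (isPerm τ) * F τ) + sumL (allFuns n n) (λ τ → 𝟙 (isPerm τ) * G τ)
                                                                 ≡⟨ cong₂ _+_ (sumPerm-as-sumL F) (sumPerm-as-sumL G) ⟨
    sumPerm n F + sumPerm n G ∎
    where open ≡-Reasoning

  sumPerm-zero : sumPerm n (λ _ → + 0) ≡ + 0
  sumPerm-zero = trans (sumL-cong (allFuns n n) (λ τ → trans (if-zero (isPerm τ) (+ 0)) (ℤP.*-zeroʳ (𝟙 (isPerm τ))))) (sumL-zero (allFuns n n))

  sumPerm-neg : (F : (Fin n → Fin n) → ℤ) → sumPerm n (λ τ → - F τ) ≡ - sumPerm n F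
  sumPerm-neg F = trans (sumPerm-cong (λ τ _ → sym (ℤP.-1*i≡-i (F τ)))) (trans (sumPerm-*ˡ (- + 1) F) (ℤP.-1*i≡-i _))

  sumL-sumPerm : {A : Set} (l : List A) (F : A → (Fin n → Fin n) → ℤ) →
                 sumL l (λ x → sumPerm n (F x)) ≡ sumPerm n (λ τ → sumL l (λ x → F x τ))
  sumL-sumPerm l F = begin
    sumL l (λ x → sumPerm n (F x))
      ≡⟨ sumL-comm l (allFuns n n) _ ⟩
    sumL (allFuns n n) (λ τ → sumL l (λ x → if isPerm τ then F x τ else + 0))
      ≡⟨ sumL-cong (allFuns n n) (λ τ → trans (sumL-cong l (λ x → if-zero (isPerm τ) (F x τ))) (sumL-*ˡ l (𝟙 (isPerm τ)) _)) ⟩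
    sumL (allFuns n n) (λ τ → 𝟙 (isPerm τ) * sumL l (λ x → F x τ))
      ≡⟨ sumPerm-as-sumL _ ⟨
    sumPerm n (λ τ → sumL l (λ x → F x τ)) ∎
    where open ≡-Reasoning

allB-sound : {A : Set} (p : A → Bool) {l : List A} → allB p l ≡ true → ∀ {x} → x ∈ l → p x ≡ true
allB-sound p {y ∷ l} all-p (here refl) with p y
... | true = refl
allB-sound p {y ∷ l} all-p (there x∈l) with p y
... | true = allB-sound p all-p x∈l

allB-complete : {A : Set} (p : A → Bool) (l : List A) → (∀ x → p x ≡ true) → allB p l ≡ true
allB-complete p []      all-p = refl
allB-complete p (x ∷ l) all-p rewrite all-p x = allB-complete p l all-p

allB-cong : {A : Set} {p p′ : A → Bool} → (∀ x → p x ≡ p′ x) → (l : List A) → allB p l ≡ allB p′ l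
allB-cong e []      = refl
allB-cong e (x ∷ l) = cong₂ _∧_ (e x) (allB-cong e l)

module _ {n : ℕ} (τ : Fin n → Fin n) where

  isPerm⇒injective : isPerm τ ≡ true → Injective _≡_ _≡_ τ
  isPerm⇒injective perm {i} {j} τi≡τj = pair-ok (allB-sound _ (allB-sound _ perm (∈-allFin i)) (∈-allFin j))
    where
    pair-ok : (not ⌊ τ i ≟ τ j ⌋ ∨ ⌊ i ≟ j ⌋) ≡ true → i ≡ j
    pair-ok ok with τ i ≟ τ j | i ≟ j
    pair-ok ok  | _       | yes i≡j = i≡j
    pair-ok ()  | yes _   | no _
    pair-ok ok  | no τi≢τj | no _   = contradiction τi≡τj τi≢τj

  injective⇒isPerm : Injective _≡_ _≡_ τ → isPerm τ ≡ true
  injective⇒isPerm inj = allB-complete _ (allFin n) (λ i → allB-complete _ (allFin n) (pair-ok i))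
    where
    pair-ok : ∀ i j → (not ⌊ τ i ≟ τ j ⌋ ∨ ⌊ i ≟ j ⌋) ≡ true
    pair-ok i j with τ i ≟ τ j | i ≟ j
    ... | no _      | _      = refl
    ... | yes _     | yes _  = refl
    ... | yes τi≡τj | no i≢j = contradiction (inj τi≡τj) i≢j

injective-cong : {A B : Set} {f g : A → B} → f ≗ g → Injective _≡_ _≡_ f → Injective _≡_ _≡_ g
injective-cong f≗g f-inj e = f-inj (trans (f≗g _) (trans e (sym (f≗g _))))

isPerm-cong : {n : ℕ} {f g : Fin n → Fin n} → f ≗ g → isPerm f ≡ isPerm g
isPerm-cong {f = f} {g} f≗g with isPerm f in pf | isPerm g in pg
... | true  | true  = refl
... | false | false = refl
... | true  | false = contradiction (trans (sym pg) (injective⇒isPerm g (injective-cong f≗g (isPerm⇒injective f pf)))) λ ()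
... | false | true  = contradiction (trans (sym pf) (injective⇒isPerm f (injective-cong (sym ∘ f≗g) (isPerm⇒injective g pg)))) λ ()

sumPerm-sift : (n : ℕ) (h : (Fin n → Fin n) → ℤ) → Respects≗ h → (ρ : Fin n → Fin n) → Injective _≡_ _≡_ ρ →
               sumPerm n (λ τ → 𝟙 (does (τ ≗? ρ)) * h τ) ≡ h ρ
sumPerm-sift n h resp ρ ρ-inj = begin
  sumPerm n (λ τ → 𝟙 (does (τ ≗? ρ)) * h τ)
    ≡⟨ sumPerm-as-sumL n _ ⟩
  sumL (allFuns n n) (λ τ → 𝟙 (isPerm τ) * (𝟙 (does (τ ≗? ρ)) * h τ))
    ≡⟨ sumL-cong (allFuns n n) (λ τ → solve 3 (λ x y z → x :* (y :* z) := y :* (x :* z)) refl (𝟙 (isPerm τ)) (𝟙 (does (τ ≗? ρ))) (h τ)) ⟩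
  sumL (allFuns n n) (λ τ → 𝟙 (does (τ ≗? ρ)) * (𝟙 (isPerm τ) * h τ))
    ≡⟨ allFuns-sift n n (λ τ → 𝟙 (isPerm τ) * h τ) (λ e → cong₂ _*_ (cong 𝟙 (isPerm-cong e)) (resp e)) ρ ⟩
  𝟙 (isPerm ρ) * h ρ
    ≡⟨ cong (λ b → 𝟙 b * h ρ) (injective⇒isPerm ρ ρ-inj) ⟩
  + 1 * h ρ
    ≡⟨ ℤP.*-identityˡ (h ρ) ⟩
  h ρ ∎
  where open ≡-Reasoning

module _ (m n : ℕ) where

  sumPerm-comm : (H : (Fin m → Fin m) → (Fin n → Fin n) → ℤ) →
                 sumPerm m (λ σ → sumPerm n (H σ)) ≡ sumPerm n (λ τ → sumPerm m (λ σ → H σ τ))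
  sumPerm-comm H = begin
    sumPerm m (λ σ → sumPerm n (H σ))
      ≡⟨ sumPerm-as-sumL m _ ⟩
    sumL (allFuns m m) (λ σ → 𝟙 (isPerm σ) * sumPerm n (H σ))
      ≡⟨ sumL-cong (allFuns m m) (λ σ → sym (sumPerm-*ˡ n (𝟙 (isPerm σ)) (H σ))) ⟩
    sumL (allFuns m m) (λ σ → sumPerm n (λ τ → 𝟙 (isPerm σ) * H σ τ))
      ≡⟨ sumL-sumPerm n (allFuns m m) _ ⟩
    sumPerm n (λ τ → sumL (allFuns m m) (λ σ → 𝟙 (isPerm σ) * H σ τ))
      ≡⟨ sumPerm-cong n (λ τ _ → sym (sumPerm-as-sumL m (λ σ → H σ τ))) ⟩
    sumPerm n (λ τ → sumPerm m (λ σ → H σ τ)) ∎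
    where open ≡-Reasoning

sumPerm-∑ : (m n : ℕ) (H : (Fin m → Fin m) → Fin n → ℤ) →
            sumPerm m (λ σ → ∑[ j < n ] H σ j) ≡ ∑[ j < n ] sumPerm m (λ σ → H σ j)
sumPerm-∑ m n H = begin
  sumPerm m (λ σ → ∑[ j < n ] H σ j)
    ≡⟨ sumPerm-as-sumL m _ ⟩
  sumL (allFuns m m) (λ σ → 𝟙 (isPerm σ) * ∑[ j < n ] H σ j)
    ≡⟨ sumL-cong (allFuns m m) (λ σ → *-distribˡ-sum {n} (𝟙 (isPerm σ)) (H σ)) ⟩
  sumL (allFuns m m) (λ σ → ∑[ j < n ] (𝟙 (isPerm σ) * H σ j))
    ≡⟨ sumL-∑-comm (allFuns m m) (λ σ j → 𝟙 (isPerm σ) * H σ j) ⟩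
  ∑[ j < n ] sumL (allFuns m m) (λ σ → 𝟙 (isPerm σ) * H σ j)
    ≡⟨ sum-cong-≗ {n} (λ j → sym (sumPerm-as-sumL m (λ σ → H σ j))) ⟩
  ∑[ j < n ] sumPerm m (λ σ → H σ j) ∎
  where open ≡-Reasoning

isExc isFix isDeficiency : {n : ℕ} → (Fin n → Fin n) → Fin n → Bool
isExc τ i = toℕ i <ᵇ toℕ (τ i)
isFix τ i = ⌊ τ i ≟ i ⌋
isDeficiency τ i = toℕ (τ i) <ᵇ toℕ i

isCycleMin : {n : ℕ} → (Fin n → Fin n) → Fin n → Bool
isCycleMin {n} τ i = allB (λ k → toℕ i ≤ᵇ toℕ (iter τ (toℕ k) i)) (allFin n)

data Kind {n : ℕ} (τ : Fin n → Fin n) (k : Fin n) : Set where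
  excedance  : isExc τ k ≡ true  → isFix τ k ≡ false → isDeficiency τ k ≡ false → Kind τ k
  fixedPoint : isExc τ k ≡ false → isFix τ k ≡ true  → isDeficiency τ k ≡ false → Kind τ k
  deficiency : isExc τ k ≡ false → isFix τ k ≡ false → isDeficiency τ k ≡ true  → Kind τ k

kind : {n : ℕ} (τ : Fin n → Fin n) (k : Fin n) → Kind τ k
kind τ k with ℕP.<-cmp (toℕ k) (toℕ (τ k))
... | tri< k<τk k≢τk _ = excedance (<ᵇ-true k<τk) (⌊≟⌋-false (k≢τk ∘ sym ∘ cong toℕ)) (<ᵇ-false (ℕP.<⇒≤ k<τk))
... | tri≈ _ k≡τk _ = fixedPoint (<ᵇ-false (ℕP.≤-reflexive (sym k≡τk)))
                                 (subst (λ y → ⌊ y ≟ k ⌋ ≡ true) (FinP.toℕ-injective k≡τk) (⌊≟⌋-refl k))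
                                 (<ᵇ-false (ℕP.≤-reflexive k≡τk))
... | tri> _ k≢τk τk<k = deficiency (<ᵇ-false (ℕP.<⇒≤ τk<k)) (⌊≟⌋-false (k≢τk ∘ sym ∘ cong toℕ)) (<ᵇ-true τk<k)

-- exc, fix and cyc of Defs ignore the colour vector; these are the same
-- counts for a bare permutation, so that e.g. exc z τ = exc′ τ by refl.
exc′ fix′ cyc′ : {n : ℕ} → (Fin n → Fin n) → ℕ
exc′ τ = count (isExc τ)
fix′ τ = count (isFix τ)
cyc′ τ = count (isCycleMin τ)

Pₛ : (n : ℕ) (q t s : ℤ) → ℤ
Pₛ n q t s = sumPerm n (λ τ → q ^ exc′ τ * t ^ fix′ τ * s ^ cyc′ τ)

module _ {n : ℕ} {τ τ′ : Fin n → Fin n} (τ≗τ′ : τ ≗ τ′) where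

  iter-cong : (k : ℕ) (y : Fin n) → iter τ k y ≡ iter τ′ k y
  iter-cong zero    y = refl
  iter-cong (suc k) y = trans (cong τ (iter-cong k y)) (τ≗τ′ _)

  exc′-cong : exc′ τ ≡ exc′ τ′
  exc′-cong = count-cong (λ i → cong (λ y → toℕ i <ᵇ toℕ y) (τ≗τ′ i))

  fix′-cong : fix′ τ ≡ fix′ τ′
  fix′-cong = count-cong (λ i → cong (λ y → ⌊ y ≟ i ⌋) (τ≗τ′ i))

  cyc′-cong : cyc′ τ ≡ cyc′ τ′
  cyc′-cong = count-cong {p = isCycleMin τ} {isCycleMin τ′}
    (λ i → allB-cong (λ k → cong (λ y → toℕ i ≤ᵇ toℕ y) (iter-cong (toℕ k) i)) (allFin n))

geometric : (m : ℕ) (q : ℤ) → ∑[ a < m ] (q ^ toℕ a) ≡ qint m q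
geometric zero    q = refl
geometric (suc m) q = begin
  ∑[ a < suc m ] (q ^ toℕ a)
    ≡⟨ sum-init-last {m} (λ a → q ^ toℕ a) ⟩
  ∑[ a < m ] (q ^ toℕ (inject₁ a)) + q ^ toℕ (fromℕ m)
    ≡⟨ cong₂ (λ s k → s + q ^ k) (sum-cong-≗ {m} (λ a → cong (q ^_) (FinP.toℕ-inject₁ a))) (FinP.toℕ-fromℕ m) ⟩
  ∑[ a < m ] (q ^ toℕ a) + q ^ m
    ≡⟨ cong (_+ q ^ m) (geometric m q) ⟩
  qint (suc m) q ∎
  where open ≡-Reasoning

allFuns-pow : (n m : ℕ) (q R : ℤ) (φ : Fin n → Fin m → ℕ) (e : Fin n → ℕ) →
              (∀ i → ∑[ a < m ] (q ^ φ i a) ≡ q ^ e i * R) →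
              sumL (allFuns n m) (λ z → q ^ ℕΣ.sum (λ i → φ i (z i))) ≡ q ^ ℕΣ.sum e * R ^ n
allFuns-pow zero    m q R φ e h = ℤP.+-identityʳ (+ 1)
allFuns-pow (suc n) m q R φ e h = begin
  sumL (allFuns (suc n) m) (λ z → q ^ ℕΣ.sum (λ i → φ i (z i)))
    ≡⟨ sumL-allFuns-suc n m _ ⟩
  sumL (allFuns n m) (λ z → ∑[ a < m ] (q ^ (φ zero a ℕ.+ Σz z)))
    ≡⟨ sumL-cong (allFuns n m) (λ z → trans (sum-cong-≗ {m} (λ a → ℤP.^-distribˡ-+-* q (φ zero a) (Σz z)))
                                            (sym (*-distribʳ-sum (q ^ Σz z) (λ a → q ^ φ zero a)))) ⟩
  sumL (allFuns n m) (λ z → ∑[ a < m ] (q ^ φ zero a) * q ^ Σz z)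
    ≡⟨ trans (sumL-cong (allFuns n m) (λ z → cong (_* q ^ Σz z) (h zero))) (sumL-*ˡ (allFuns n m) (q ^ e zero * R) _) ⟩
  q ^ e zero * R * sumL (allFuns n m) (λ z → q ^ Σz z)
    ≡⟨ cong (q ^ e zero * R *_) (allFuns-pow n m q R (φ ∘ suc) (e ∘ suc) (h ∘ suc)) ⟩
  q ^ e zero * R * (q ^ ℕΣ.sum (e ∘ suc) * R ^ n)
    ≡⟨ solve 4 (λ x y u v → x :* u :* (y :* v) := x :* y :* (u :* v)) refl (q ^ e zero) (q ^ ℕΣ.sum (e ∘ suc)) R (R ^ n) ⟩
  q ^ e zero * q ^ ℕΣ.sum (e ∘ suc) * R ^ suc n
    ≡⟨ cong (_* R ^ suc n) (ℤP.^-distribˡ-+-* q (e zero) _) ⟨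
  q ^ ℕΣ.sum e * R ^ suc n ∎
  where
  open ≡-Reasoning
  Σz : (Fin n → Fin m) → ℕ
  Σz z = ℕΣ.sum (λ i → φ (suc i) (z i))

colourExp : Stat → (r : ℕ) {n : ℕ} → (Fin n → Fin n) → Fin n → Fin r → ℕ
colourExp Abs r     τ i a = 𝟙ℕ (isExc τ i) ℕ.+ toℕ a
colourExp Clr r {n} τ i a = r ℕ.* 𝟙ℕ ((suc (toℕ i) <ᵇ n) ∧ (toℕ a ℕ.≡ᵇ 0) ∧ isExc τ i) ℕ.+ toℕ a

excO≡sum-colourExp : (O : Stat) (r : ℕ) {n : ℕ} (z : Fin n → Fin r) (τ : Fin n → Fin n) →
                     excO O r z τ ≡ ℕΣ.sum (λ i → colourExp O r τ i (z i))
excO≡sum-colourExp Abs r z τ = begin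
  exc z τ ℕ.+ csum z τ                          ≡⟨ cong₂ ℕ._+_ (count≡sum (isExc τ)) (csum≡sum z τ) ⟩
  ℕΣ.sum (𝟙ℕ ∘ isExc τ) ℕ.+ ℕΣ.sum (toℕ ∘ z)    ≡⟨ ℕΣ.∑-distrib-+ (𝟙ℕ ∘ isExc τ) (toℕ ∘ z) ⟨
  ℕΣ.sum (λ i → colourExp Abs r τ i (z i))      ∎
  where open ≡-Reasoning
excO≡sum-colourExp Clr r {n} z τ = begin
  r ℕ.* excA z τ ℕ.+ csum z τ                   ≡⟨ cong₂ (λ x y → r ℕ.* x ℕ.+ y) (count≡sum excA-at) (csum≡sum z τ) ⟩
  r ℕ.* ℕΣ.sum (𝟙ℕ ∘ excA-at) ℕ.+ ℕΣ.sum (toℕ ∘ z) ≡⟨ cong (ℕ._+ ℕΣ.sum (toℕ ∘ z)) (ℕΣ.*-distribˡ-sum r (𝟙ℕ ∘ excA-at)) ⟩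
  ℕΣ.sum (λ i → r ℕ.* 𝟙ℕ (excA-at i)) ℕ.+ ℕΣ.sum (toℕ ∘ z) ≡⟨ ℕΣ.∑-distrib-+ (λ i → r ℕ.* 𝟙ℕ (excA-at i)) (toℕ ∘ z) ⟨
  ℕΣ.sum (λ i → colourExp Clr r τ i (z i))      ∎
  where
  open ≡-Reasoning
  excA-at : Fin n → Bool
  excA-at i = (suc (toℕ i) <ᵇ n) ∧ (toℕ (z i) ℕ.≡ᵇ 0) ∧ isExc τ i

colourExp-sum : (O : Stat) (r′ : ℕ) {n : ℕ} (q : ℤ) (τ : Fin n → Fin n) (i : Fin n) →
                ∑[ a < suc r′ ] (q ^ colourExp O (suc r′) τ i a) ≡ q ^ 𝟙ℕ (isExc τ i) * qint (suc r′) q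
colourExp-sum Abs r′ q τ i = begin
  ∑[ a < suc r′ ] (q ^ (c ℕ.+ toℕ a))      ≡⟨ sum-cong-≗ {suc r′} (λ a → ℤP.^-distribˡ-+-* q c (toℕ a)) ⟩
  ∑[ a < suc r′ ] (q ^ c * q ^ toℕ a)      ≡⟨ *-distribˡ-sum {suc r′} (q ^ c) (λ a → q ^ toℕ a) ⟨
  q ^ c * ∑[ a < suc r′ ] (q ^ toℕ a)      ≡⟨ cong (q ^ c *_) (geometric (suc r′) q) ⟩
  q ^ c * qint (suc r′) q                  ∎
  where
  open ≡-Reasoning
  c = 𝟙ℕ (isExc τ i)
colourExp-sum Clr r′ {n} q τ i = by-cases (isExc τ i) refl
  where
  open ≡-Reasoning
  by-cases : (b : Bool) → isExc τ i ≡ b →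
             ∑[ a < suc r′ ] (q ^ colourExp Clr (suc r′) τ i a) ≡ q ^ 𝟙ℕ b * qint (suc r′) q
  by-cases false exc-i = begin
    ∑[ a < suc r′ ] (q ^ colourExp Clr (suc r′) τ i a) ≡⟨ sum-cong-≗ {suc r′} (λ a → cong (q ^_) (not-exc a)) ⟩
    ∑[ a < suc r′ ] (q ^ toℕ a)                         ≡⟨ geometric (suc r′) q ⟩
    qint (suc r′) q                                     ≡⟨ ℤP.*-identityˡ _ ⟨
    + 1 * qint (suc r′) q                               ∎
    where
      not-exc : ∀ a → colourExp Clr (suc r′) τ i a ≡ toℕ a
      not-exc a rewrite exc-i | ∧-zeroʳ (toℕ a ℕ.≡ᵇ 0) | ∧-zeroʳ (suc (toℕ i) <ᵇ n) | ℕP.*-zeroʳ r′ = refl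
  by-cases true exc-i = begin
    q ^ colourExp Clr (suc r′) τ i zero + ∑[ a < r′ ] (q ^ colourExp Clr (suc r′) τ i (suc a))
      ≡⟨ cong₂ _+_ (cong (q ^_) at-zero) (sum-cong-≗ {r′} (λ a → cong (q ^_) (at-suc a))) ⟩
    q ^ suc r′ + ∑[ a < r′ ] (q * q ^ toℕ a)
      ≡⟨ cong (_+_ (q ^ suc r′)) (trans (sym (*-distribˡ-sum {r′} q (λ a → q ^ toℕ a))) (cong (q *_) (geometric r′ q))) ⟩
    q ^ suc r′ + q * qint r′ q
      ≡⟨ solve 3 (λ x y z → x :* z :+ x :* y := (x :* con (+ 1)) :* (y :+ z)) refl q (qint r′ q) (q ^ r′) ⟩
    q ^ 1 * qint (suc r′) q ∎
    where
      i+1<n : suc (toℕ i) ℕ.< n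
      i+1<n = ℕP.<-≤-trans (ℕ.s≤s (<ᵇ-true⁻¹ exc-i)) (FinP.toℕ<n (τ i))
      at-zero : colourExp Clr (suc r′) τ i zero ≡ suc r′
      at-zero rewrite exc-i | <ᵇ-true i+1<n = trans (ℕP.+-identityʳ _) (ℕP.*-identityʳ (suc r′))
      at-suc : ∀ a → colourExp Clr (suc r′) τ i (suc a) ≡ suc (toℕ a)
      at-suc a rewrite ∧-zeroʳ (suc (toℕ i) <ᵇ n) | ℕP.*-zeroʳ r′ = refl

colour-sum : (O : Stat) (r′ : ℕ) {n : ℕ} (q : ℤ) (τ : Fin n → Fin n) →
             sumL (allFuns n (suc r′)) (λ z → q ^ excO O (suc r′) z τ) ≡ q ^ exc′ τ * qint (suc r′) q ^ n
colour-sum O r′ {n} q τ = begin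
  sumL (allFuns n (suc r′)) (λ z → q ^ excO O (suc r′) z τ)
    ≡⟨ sumL-cong (allFuns n (suc r′)) (λ z → cong (q ^_) (excO≡sum-colourExp O (suc r′) z τ)) ⟩
  sumL (allFuns n (suc r′)) (λ z → q ^ ℕΣ.sum (λ i → colourExp O (suc r′) τ i (z i)))
    ≡⟨ allFuns-pow n (suc r′) q (qint (suc r′) q) (colourExp O (suc r′) τ) (𝟙ℕ ∘ isExc τ) (colourExp-sum O r′ q τ) ⟩
  q ^ ℕΣ.sum (𝟙ℕ ∘ isExc τ) * qint (suc r′) q ^ n
    ≡⟨ cong (λ e → q ^ e * qint (suc r′) q ^ n) (count≡sum (isExc τ)) ⟨
  q ^ exc′ τ * qint (suc r′) q ^ n ∎
  where open ≡-Reasoning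

P≡qint^n*Pₛ : (O : Stat) (r′ n : ℕ) (q t s : ℤ) → P O (suc r′) n q t s ≡ qint (suc r′) q ^ n * Pₛ n q t s
P≡qint^n*Pₛ O r′ n q t s = begin
  sumL (allFuns n r) (λ z → sumPerm n (λ τ → q ^ excO O r z τ * t ^ fix′ τ * s ^ cyc′ τ))
    ≡⟨ sumL-cong (allFuns n r) (λ z → sumPerm-cong n (λ τ _ → ℤP.*-assoc (q ^ excO O r z τ) _ _)) ⟩
  sumL (allFuns n r) (λ z → sumPerm n (λ τ → q ^ excO O r z τ * W τ))
    ≡⟨ sumL-sumPerm n (allFuns n r) _ ⟩
  sumPerm n (λ τ → sumL (allFuns n r) (λ z → q ^ excO O r z τ * W τ))
    ≡⟨ sumPerm-cong n (λ τ _ → trans (sumL-*ʳ (allFuns n r) (W τ) _) (cong (_* W τ) (colour-sum O r′ q τ))) ⟩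
  sumPerm n (λ τ → q ^ exc′ τ * R * W τ)
    ≡⟨ sumPerm-cong n (λ τ _ → solve 3 (λ x y z → x :* y :* z := y :* (x :* z)) refl (q ^ exc′ τ) R (W τ)) ⟩
  sumPerm n (λ τ → R * (q ^ exc′ τ * W τ))
    ≡⟨ sumPerm-*ˡ n R _ ⟩
  R * sumPerm n (λ τ → q ^ exc′ τ * W τ)
    ≡⟨ cong (R *_) (sumPerm-cong n (λ τ _ → sym (ℤP.*-assoc (q ^ exc′ τ) _ _))) ⟩
  R * Pₛ n q t s ∎
  where
  open ≡-Reasoning
  r = suc r′
  R = qint r q ^ n
  W : (Fin n → Fin n) → ℤ
  W τ = t ^ fix′ τ * s ^ cyc′ τ

module _ {n : ℕ} where

  top-or-inject₁ : (i : Fin (suc n)) → i ≡ fromℕ n ⊎ ∃ λ x → i ≡ inject₁ x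
  top-or-inject₁ i with view i
  ... | ‵fromℕ      = inj₁ refl
  ... | ‵inject₁ x  = inj₂ (x , refl)

  extendᵛ : (Fin n → Fin n) → {i : Fin (suc n)} → View i → Fin (suc n)
  extendᵛ τ ‵fromℕ       = fromℕ n
  extendᵛ τ (‵inject₁ x) = inject₁ (τ x)

  extend : (Fin n → Fin n) → Fin (suc n) → Fin (suc n)
  extend τ i = extendᵛ τ (view i)

  extend-top : (τ : Fin n → Fin n) → extend τ (fromℕ n) ≡ fromℕ n
  extend-top τ = cong (extendᵛ τ) (view-fromℕ n)

  extend-inject₁ : (τ : Fin n → Fin n) (x : Fin n) → extend τ (inject₁ x) ≡ inject₁ (τ x)
  extend-inject₁ τ x = cong (extendᵛ τ) (view-inject₁ x)

  extend-cong : {τ τ′ : Fin n → Fin n} → τ ≗ τ′ → extend τ ≗ extend τ′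
  extend-cong {τ} {τ′} e i with top-or-inject₁ i
  ... | inj₁ refl       = trans (extend-top τ) (sym (extend-top τ′))
  ... | inj₂ (x , refl) = trans (extend-inject₁ τ x) (trans (cong inject₁ (e x)) (sym (extend-inject₁ τ′ x)))

  extend-injective : {τ : Fin n → Fin n} → Injective _≡_ _≡_ τ → Injective _≡_ _≡_ (extend τ)
  extend-injective {τ} τ-inj {i} {j} e with top-or-inject₁ i | top-or-inject₁ j
  ... | inj₁ refl       | inj₁ refl       = refl
  ... | inj₁ refl       | inj₂ (y , refl) = contradiction (trans (sym (extend-top τ)) (trans e (extend-inject₁ τ y))) FinP.fromℕ≢inject₁
  ... | inj₂ (x , refl) | inj₁ refl       = contradiction (trans (sym (extend-top τ)) (trans (sym e) (extend-inject₁ τ x))) FinP.fromℕ≢inject₁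
  ... | inj₂ (x , refl) | inj₂ (y , refl) =
    cong inject₁ (τ-inj (FinP.inject₁-injective (trans (sym (extend-inject₁ τ x)) (trans e (extend-inject₁ τ y)))))

  restrictᵛ : Fin n → {i : Fin (suc n)} → View i → Fin n
  restrictᵛ x ‵fromℕ       = x
  restrictᵛ x (‵inject₁ y) = y

  -- Meant for maps fixing the top element fromℕ n; a point sent to the top
  -- is sent to itself (junk).
  restrict : (Fin (suc n) → Fin (suc n)) → Fin n → Fin n
  restrict ρ x = restrictᵛ x (view (ρ (inject₁ x)))

  restrict-inject₁ : (ρ : Fin (suc n) → Fin (suc n)) {x y : Fin n} → ρ (inject₁ x) ≡ inject₁ y → restrict ρ x ≡ y
  restrict-inject₁ ρ {x} {y} e = trans (cong (restrictᵛ x ∘ view) e) (cong (restrictᵛ x) (view-inject₁ y))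

  restrict-cong : {ρ ρ′ : Fin (suc n) → Fin (suc n)} → ρ ≗ ρ′ → restrict ρ ≗ restrict ρ′
  restrict-cong e x = cong (restrictᵛ x ∘ view) (e (inject₁ x))

  restrict-extend : (τ : Fin n → Fin n) → restrict (extend τ) ≗ τ
  restrict-extend τ x = restrict-inject₁ (extend τ) {x} (extend-inject₁ τ x)

  module _ {ρ : Fin (suc n) → Fin (suc n)} (ρ-inj : Injective _≡_ _≡_ ρ) (ρ-top : ρ (fromℕ n) ≡ fromℕ n) where

    extend-restrict : extend (restrict ρ) ≗ ρ
    extend-restrict i with top-or-inject₁ i
    ... | inj₁ refl = trans (extend-top (restrict ρ)) (sym ρ-top)
    ... | inj₂ (x , refl) with top-or-inject₁ (ρ (inject₁ x))
    ...   | inj₁ ρx≡top       = contradiction (ρ-inj (trans ρx≡top (sym ρ-top))) (FinP.fromℕ≢inject₁ ∘ sym)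
    ...   | inj₂ (y , ρx≡y) = trans (extend-inject₁ (restrict ρ) x) (trans (cong inject₁ (restrict-inject₁ ρ ρx≡y)) (sym ρx≡y))

    restrict-injective : Injective _≡_ _≡_ (restrict ρ)
    restrict-injective {x} {y} e = FinP.inject₁-injective (ρ-inj (begin
      ρ (inject₁ x)                     ≡⟨ extend-restrict (inject₁ x) ⟨
      extend (restrict ρ) (inject₁ x)   ≡⟨ extend-inject₁ (restrict ρ) x ⟩
      inject₁ (restrict ρ x)            ≡⟨ cong inject₁ e ⟩
      inject₁ (restrict ρ y)            ≡⟨ extend-inject₁ (restrict ρ) y ⟨
      extend (restrict ρ) (inject₁ y)   ≡⟨ extend-restrict (inject₁ y) ⟩
      ρ (inject₁ y)                     ∎))
      where open ≡-Reasoning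

module _ {n : ℕ} where

  transpose-first : (i j : Fin n) → transpose i j i ≡ j
  transpose-first i j rewrite dec-true (i ≟ i) refl = refl

  transpose-second : (i j : Fin n) → transpose i j j ≡ i
  transpose-second i j with j ≟ i
  ... | yes j≡i = j≡i
  ... | no  _   rewrite dec-true (j ≟ j) refl = refl

  transpose-other : {i j k : Fin n} → k ≢ i → k ≢ j → transpose i j k ≡ k
  transpose-other {i} {j} {k} k≢i k≢j rewrite dec-false (k ≟ i) k≢i | dec-false (k ≟ j) k≢j = refl

  transpose-injective : (i j : Fin n) → Injective _≡_ _≡_ (transpose i j)
  transpose-injective i j {x} {y} e = begin
    x                                 ≡⟨ transpose-inverse j i ⟨
    transpose j i (transpose i j x)   ≡⟨ cong (transpose j i) e ⟩
    transpose j i (transpose i j y)   ≡⟨ transpose-inverse j i ⟩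
    y                                 ∎
    where open ≡-Reasoning

module _ {n : ℕ} where

  -- insert τ j puts the new element n into the cycle of j, right after j
  -- (as a new fixed point when j = n).
  insert : (Fin n → Fin n) → Fin (suc n) → Fin (suc n) → Fin (suc n)
  insert τ j = extend τ ∘ transpose j (fromℕ n)

  remove : (Fin (suc n) → Fin (suc n)) → Fin (suc n) → Fin n → Fin n
  remove σ j = restrict (σ ∘ transpose (fromℕ n) j)

  insert-injective : {τ : Fin n → Fin n} → Injective _≡_ _≡_ τ → (j : Fin (suc n)) → Injective _≡_ _≡_ (insert τ j)
  insert-injective τ-inj j = transpose-injective j (fromℕ n) ∘ extend-injective τ-inj

  insert-cong : {τ τ′ : Fin n → Fin n} → τ ≗ τ′ → (j : Fin (suc n)) → insert τ j ≗ insert τ′ j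
  insert-cong e j y = extend-cong e (transpose j (fromℕ n) y)

  insert-at : (τ : Fin n → Fin n) (j : Fin (suc n)) → insert τ j j ≡ fromℕ n
  insert-at τ j = trans (cong (extend τ) (transpose-first j (fromℕ n))) (extend-top τ)

  insert-top : (τ : Fin n → Fin n) (j : Fin (suc n)) → insert τ j (fromℕ n) ≡ extend τ j
  insert-top τ j = cong (extend τ) (transpose-second j (fromℕ n))

  insert-inject₁ : (τ : Fin n → Fin n) {j : Fin (suc n)} {x : Fin n} → inject₁ x ≢ j → insert τ j (inject₁ x) ≡ inject₁ (τ x)
  insert-inject₁ τ x≢j = trans (cong (extend τ) (transpose-other x≢j (FinP.fromℕ≢inject₁ ∘ sym))) (extend-inject₁ τ _)

  remove-insert : (τ : Fin n → Fin n) (j : Fin (suc n)) → remove (insert τ j) j ≗ τ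
  remove-insert τ j x = trans (restrict-cong (λ y → cong (extend τ) (transpose-inverse j (fromℕ n) {y})) x) (restrict-extend τ x)

  module _ {σ : Fin (suc n) → Fin (suc n)} (σ-inj : Injective _≡_ _≡_ σ) {j : Fin (suc n)} (σj≡top : σ j ≡ fromℕ n) where

    private
      σ′ : Fin (suc n) → Fin (suc n)
      σ′ = σ ∘ transpose (fromℕ n) j

      σ′-inj : Injective _≡_ _≡_ σ′
      σ′-inj = transpose-injective (fromℕ n) j ∘ σ-inj

      σ′-top : σ′ (fromℕ n) ≡ fromℕ n
      σ′-top = trans (cong σ (transpose-first (fromℕ n) j)) σj≡top

    remove-injective : Injective _≡_ _≡_ (remove σ j)
    remove-injective = restrict-injective σ′-inj σ′-top

    insert-remove : insert (remove σ j) j ≗ σ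
    insert-remove y = trans (extend-restrict σ′-inj σ′-top (transpose j (fromℕ n) y)) (cong σ (transpose-inverse (fromℕ n) j))

    ≗-insert : (τ : Fin n → Fin n) (j′ : Fin (suc n)) → does (σ ≗? insert τ j′) ≡ does (τ ≗? remove σ j) ∧ does (j′ ≟ j)
    ≗-insert τ j′ = compare (σ ≗? insert τ j′) (τ ≗? remove σ j) (j′ ≟ j)
      where
      compare : (a : Dec (σ ≗ insert τ j′)) (b : Dec (τ ≗ remove σ j)) (c : Dec (j′ ≡ j)) → does a ≡ does b ∧ does c
      compare (yes _)   (yes _)    (yes _)    = refl
      compare (no σ≉)   (yes τ≗)   (yes refl) = contradiction (λ y → sym (trans (insert-cong τ≗ j y) (insert-remove y))) σ≉
      compare (no _)    (yes _)    (no _)     = refl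
      compare (no _)    (no _)     _          = refl
      compare (yes σ≗)  _          (no j′≢j)  = contradiction (σ-inj (trans (σ≗ j′) (trans (insert-at τ j′) (sym σj≡top)))) j′≢j
      compare (yes σ≗)  (no τ≉)    (yes refl) =
        contradiction (λ x → trans (sym (remove-insert τ j x)) (restrict-cong (λ y → sym (σ≗ (transpose (fromℕ n) j y))) x)) τ≉

-- An injective endomap of Fin (suc n) missing the top element would
-- inject Fin (suc n) into Fin n.
top-preimage : {n : ℕ} {σ : Fin (suc n) → Fin (suc n)} → Injective _≡_ _≡_ σ → ∃ λ j → σ j ≡ fromℕ n
top-preimage {n} {σ} σ-inj with FinP.any? (λ j → σ j ≟ fromℕ n)
... | yes hit = hit
... | no miss = contradiction (FinP.injective⇒≤ squeeze-inj) ℕP.1+n≰n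
  where
  squeeze : Fin (suc n) → Fin n
  squeeze j = punchOut {i = fromℕ n} (λ e → miss (j , sym e))
  squeeze-inj : Injective _≡_ _≡_ squeeze
  squeeze-inj {x} {y} e = σ-inj (FinP.punchOut-injective (λ e′ → miss (x , sym e′)) (λ e′ → miss (y , sym e′)) e)

insertions≡1 : {n : ℕ} {σ : Fin (suc n) → Fin (suc n)} → Injective _≡_ _≡_ σ →
                sumPerm n (λ τ → ∑[ j < suc n ] 𝟙 (does (σ ≗? insert τ j))) ≡ + 1
insertions≡1 {n} {σ} σ-inj = begin
  sumPerm n (λ τ → ∑[ j < suc n ] 𝟙 (does (σ ≗? insert τ j)))
    ≡⟨ sumPerm-cong n (λ τ _ → sum-cong-≗ {suc n} (λ j → trans (cong 𝟙 (≗-insert σ-inj σj≡top τ j)) (𝟙-∧ (does (τ ≗? ρ)) (does (j ≟ j₀))))) ⟩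
  sumPerm n (λ τ → ∑[ j < suc n ] (𝟙 (does (τ ≗? ρ)) * 𝟙 (does (j ≟ j₀))))
    ≡⟨ sumPerm-cong n (λ τ _ → trans (sym (*-distribˡ-sum {suc n} (𝟙 (does (τ ≗? ρ))) (λ j → 𝟙 (does (j ≟ j₀))))) (cong (𝟙 (does (τ ≗? ρ)) *_) one)) ⟩
  sumPerm n (λ τ → 𝟙 (does (τ ≗? ρ)) * + 1)
    ≡⟨ sumPerm-sift n (λ _ → + 1) (λ _ → refl) ρ (remove-injective σ-inj σj≡top) ⟩
  + 1 ∎
  where
  open ≡-Reasoning
  j₀ = proj₁ (top-preimage σ-inj)
  σj≡top = proj₂ (top-preimage σ-inj)
  ρ = remove σ j₀
  one : ∑[ j < suc n ] 𝟙 (does (j ≟ j₀)) ≡ + 1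
  one = trans (sum-cong-≗ {suc n} (λ j → sym (ℤP.*-identityʳ (𝟙 (does (j ≟ j₀)))))) (∑-sift j₀ (λ _ → + 1))

sumPerm-insert : (n : ℕ) (F : (Fin (suc n) → Fin (suc n)) → ℤ) → Respects≗ F →
                 sumPerm (suc n) F ≡ sumPerm n (λ τ → ∑[ j < suc n ] F (insert τ j))
sumPerm-insert n F resp = begin
  sumPerm (suc n) F
    ≡⟨ sumPerm-cong (suc n) (λ σ perm → as-insertions σ (isPerm⇒injective σ perm)) ⟩
  sumPerm (suc n) (λ σ → sumPerm n (λ τ → ∑[ j < suc n ] (𝟙 (does (σ ≗? insert τ j)) * F σ)))
    ≡⟨ sumPerm-comm (suc n) n (λ σ τ → ∑[ j < suc n ] (𝟙 (does (σ ≗? insert τ j)) * F σ)) ⟩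
  sumPerm n (λ τ → sumPerm (suc n) (λ σ → ∑[ j < suc n ] (𝟙 (does (σ ≗? insert τ j)) * F σ)))
    ≡⟨ sumPerm-cong n (λ τ _ → sumPerm-∑ (suc n) (suc n) (λ σ j → 𝟙 (does (σ ≗? insert τ j)) * F σ)) ⟩
  sumPerm n (λ τ → ∑[ j < suc n ] sumPerm (suc n) (λ σ → 𝟙 (does (σ ≗? insert τ j)) * F σ))
    ≡⟨ sumPerm-cong n (λ τ perm → sum-cong-≗ {suc n} (λ j →
         sumPerm-sift (suc n) F resp (insert τ j) (insert-injective (isPerm⇒injective τ perm) j))) ⟩
  sumPerm n (λ τ → ∑[ j < suc n ] F (insert τ j)) ∎
  where
  open ≡-Reasoning
  as-insertions : ∀ σ → Injective _≡_ _≡_ σ → F σ ≡ sumPerm n (λ τ → ∑[ j < suc n ] (𝟙 (does (σ ≗? insert τ j)) * F σ))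
  as-insertions σ σ-inj = begin
    F σ
      ≡⟨ ℤP.*-identityˡ (F σ) ⟨
    + 1 * F σ
      ≡⟨ cong (_* F σ) (insertions≡1 σ-inj) ⟨
    sumPerm n (λ τ → ∑[ j < suc n ] 𝟙 (does (σ ≗? insert τ j))) * F σ
      ≡⟨ ℤP.*-comm _ (F σ) ⟩
    F σ * sumPerm n (λ τ → ∑[ j < suc n ] 𝟙 (does (σ ≗? insert τ j)))
      ≡⟨ sumPerm-*ˡ n (F σ) _ ⟨
    sumPerm n (λ τ → F σ * ∑[ j < suc n ] 𝟙 (does (σ ≗? insert τ j)))
      ≡⟨ sumPerm-cong n (λ τ _ → trans (*-distribˡ-sum {suc n} (F σ) (λ j → 𝟙 (does (σ ≗? insert τ j))))
                                       (sum-cong-≗ {suc n} (λ j → ℤP.*-comm (F σ) (𝟙 (does (σ ≗? insert τ j)))))) ⟩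
    sumPerm n (λ τ → ∑[ j < suc n ] (𝟙 (does (σ ≗? insert τ j)) * F σ)) ∎

module _ {n : ℕ} (τ : Fin n → Fin n) where

  private
    toℕ-top : ∀ j → toℕ (insert τ j (fromℕ n)) ≤ toℕ (fromℕ n)
    toℕ-top j = subst (toℕ (insert τ j (fromℕ n)) ≤_) (sym (FinP.toℕ-fromℕ n)) (ℕP.≤-pred (FinP.toℕ<n _))

    isExc-lift : ∀ {j} x → inject₁ x ≢ j → isExc (insert τ j) (inject₁ x) ≡ isExc τ x
    isExc-lift x x≢j = cong₂ _<ᵇ_ (FinP.toℕ-inject₁ x) (trans (cong toℕ (insert-inject₁ τ x≢j)) (FinP.toℕ-inject₁ (τ x)))

    isFix-lift : ∀ {j} x → inject₁ x ≢ j → isFix (insert τ j) (inject₁ x) ≡ isFix τ x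
    isFix-lift x x≢j = trans (cong (λ y → ⌊ y ≟ inject₁ x ⌋) (insert-inject₁ τ x≢j)) (⌊≟⌋-injective FinP.inject₁-injective (τ x) x)

  exc-insert-top : exc′ (insert τ (fromℕ n)) ≡ exc′ τ
  exc-insert-top = begin
    exc′ (insert τ (fromℕ n))
      ≡⟨ count-lift _ (isExc τ) (λ x → isExc-lift x (FinP.fromℕ≢inject₁ ∘ sym)) ⟩
    exc′ τ ℕ.+ 𝟙ℕ (isExc (insert τ (fromℕ n)) (fromℕ n))
      ≡⟨ cong (λ b → exc′ τ ℕ.+ 𝟙ℕ b) (<ᵇ-false (toℕ-top (fromℕ n))) ⟩
    exc′ τ ℕ.+ 0
      ≡⟨ ℕP.+-identityʳ (exc′ τ) ⟩
    exc′ τ ∎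
    where open ≡-Reasoning

  exc-insert-inject₁ : (k : Fin n) → exc′ (insert τ (inject₁ k)) ℕ.+ 𝟙ℕ (isExc τ k) ≡ suc (exc′ τ)
  exc-insert-inject₁ k = begin
    exc′ σ ℕ.+ 𝟙ℕ (isExc τ k)
      ≡⟨ count-lift-except _ (isExc τ) k (λ x x≢k → isExc-lift x (x≢k ∘ FinP.inject₁-injective)) ⟩
    exc′ τ ℕ.+ 𝟙ℕ (isExc σ (inject₁ k)) ℕ.+ 𝟙ℕ (isExc σ (fromℕ n))
      ≡⟨ cong₂ (λ b c → exc′ τ ℕ.+ 𝟙ℕ b ℕ.+ 𝟙ℕ c) k-exc (<ᵇ-false (toℕ-top (inject₁ k))) ⟩
    exc′ τ ℕ.+ 1 ℕ.+ 0
      ≡⟨ trans (ℕP.+-identityʳ _) (ℕP.+-comm (exc′ τ) 1) ⟩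
    suc (exc′ τ) ∎
    where
    open ≡-Reasoning
    σ = insert τ (inject₁ k)
    k-exc : isExc σ (inject₁ k) ≡ true
    k-exc = <ᵇ-true (subst₂ _<_ (sym (FinP.toℕ-inject₁ k)) (sym (trans (cong toℕ (insert-at τ (inject₁ k))) (FinP.toℕ-fromℕ n))) (FinP.toℕ<n k))

  fix-insert-top : fix′ (insert τ (fromℕ n)) ≡ suc (fix′ τ)
  fix-insert-top = begin
    fix′ σ
      ≡⟨ count-lift _ (isFix τ) (λ x → isFix-lift x (FinP.fromℕ≢inject₁ ∘ sym)) ⟩
    fix′ τ ℕ.+ 𝟙ℕ (isFix σ (fromℕ n))
      ≡⟨ cong (λ b → fix′ τ ℕ.+ 𝟙ℕ b) top-fixed ⟩
    fix′ τ ℕ.+ 1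
      ≡⟨ ℕP.+-comm (fix′ τ) 1 ⟩
    suc (fix′ τ) ∎
    where
    open ≡-Reasoning
    σ = insert τ (fromℕ n)
    top-fixed : isFix σ (fromℕ n) ≡ true
    top-fixed = trans (cong (λ y → ⌊ y ≟ fromℕ n ⌋) (insert-at τ (fromℕ n))) (⌊≟⌋-refl (fromℕ n))

  fix-insert-inject₁ : (k : Fin n) → fix′ (insert τ (inject₁ k)) ℕ.+ 𝟙ℕ (isFix τ k) ≡ fix′ τ
  fix-insert-inject₁ k = begin
    fix′ σ ℕ.+ 𝟙ℕ (isFix τ k)
      ≡⟨ count-lift-except _ (isFix τ) k (λ x x≢k → isFix-lift x (x≢k ∘ FinP.inject₁-injective)) ⟩
    fix′ τ ℕ.+ 𝟙ℕ (isFix σ (inject₁ k)) ℕ.+ 𝟙ℕ (isFix σ (fromℕ n))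
      ≡⟨ cong₂ (λ b c → fix′ τ ℕ.+ 𝟙ℕ b ℕ.+ 𝟙ℕ c) k-moved top-moved ⟩
    fix′ τ ℕ.+ 0 ℕ.+ 0
      ≡⟨ trans (ℕP.+-identityʳ _) (ℕP.+-identityʳ _) ⟩
    fix′ τ ∎
    where
    open ≡-Reasoning
    σ = insert τ (inject₁ k)
    k-moved : isFix σ (inject₁ k) ≡ false
    k-moved = trans (cong (λ y → ⌊ y ≟ inject₁ k ⌋) (insert-at τ (inject₁ k))) (⌊≟⌋-false FinP.fromℕ≢inject₁)
    top-moved : isFix σ (fromℕ n) ≡ false
    top-moved = trans (cong (λ y → ⌊ y ≟ fromℕ n ⌋) (trans (insert-top τ (inject₁ k)) (extend-inject₁ τ k)))
                      (⌊≟⌋-false (FinP.fromℕ≢inject₁ ∘ sym))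

module _ {m : ℕ} (f : Fin m → Fin m) where

  iter-+ : (a b : ℕ) (y : Fin m) → iter f (a ℕ.+ b) y ≡ iter f a (iter f b y)
  iter-+ zero    b y = refl
  iter-+ (suc a) b y = cong f (iter-+ a b y)

  module _ (f-inj : Injective _≡_ _≡_ f) where

    iter-cancel : (a : ℕ) {u v : Fin m} → iter f a u ≡ iter f a v → u ≡ v
    iter-cancel zero    e = e
    iter-cancel (suc a) e = iter-cancel a (f-inj e)

    -- By the pigeonhole principle two of y, f y, …, f^m y coincide.
    period : (y : Fin m) → ∃ λ d → 0 < d × d ≤ m × iter f d y ≡ y
    period y with FinP.pigeonhole (ℕP.n<1+n m) (λ (i : Fin (suc m)) → iter f (toℕ i) y)
    ... | i , j , i<j , fⁱy≡fʲy = d , ℕP.m<n⇒0<n∸m i<j , d≤m , sym (iter-cancel (toℕ i) (trans fⁱy≡fʲy shift))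
      where
      d = toℕ j ∸ toℕ i
      d≤m : d ≤ m
      d≤m = ℕP.≤-trans (ℕP.m∸n≤m (toℕ j) (toℕ i)) (ℕP.≤-pred (FinP.toℕ<n j))
      shift : iter f (toℕ j) y ≡ iter f (toℕ i) (iter f d y)
      shift = trans (cong (λ k → iter f k y) (sym (ℕP.m+[n∸m]≡n (ℕP.<⇒≤ i<j)))) (iter-+ (toℕ i) d y)

    orbit-bounded : (y : Fin m) (k : ℕ) → ∃ λ k′ → k′ < m × iter f k y ≡ iter f k′ y
    orbit-bounded y zero = 0 , ℕP.≤-<-trans z≤n (FinP.toℕ<n y) , refl
    orbit-bounded y (suc k) with orbit-bounded y k
    ... | k′ , k′<m , e with suc k′ ℕP.<? m
    ...   | yes k′+1<m = suc k′ , k′+1<m , cong f e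
    ...   | no  k′+1≮m = m ∸ d , ℕP.∸-monoʳ-< 0<d d≤m , (begin
      iter f (suc k) y          ≡⟨ cong f e ⟩
      iter f (suc k′) y         ≡⟨ cong (λ k → iter f k y) (ℕP.≤-antisym k′<m (ℕP.≮⇒≥ k′+1≮m)) ⟩
      iter f m y                ≡⟨ cong (λ k → iter f k y) (ℕP.m∸n+n≡m d≤m) ⟨
      iter f (m ∸ d ℕ.+ d) y    ≡⟨ iter-+ (m ∸ d) d y ⟩
      iter f (m ∸ d) (iter f d y) ≡⟨ cong (iter f (m ∸ d)) fᵈy≡y ⟩
      iter f (m ∸ d) y          ∎)
      where
      open ≡-Reasoning
      d = proj₁ (period y)
      0<d = proj₁ (proj₂ (period y))
      d≤m = proj₁ (proj₂ (proj₂ (period y)))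
      fᵈy≡y = proj₂ (proj₂ (proj₂ (period y)))

  IsCycleMin : Fin m → Set
  IsCycleMin y = ∀ k → toℕ y ≤ toℕ (iter f k y)

  isCycleMin-complete : {y : Fin m} → IsCycleMin y → isCycleMin f y ≡ true
  isCycleMin-complete y-min = allB-complete _ (allFin m) (λ k → ≤ᵇ-true (y-min (toℕ k)))

  -- The definition of cyc only inspects the first m iterates; for a
  -- permutation these already exhaust the orbit.
  isCycleMin-sound : Injective _≡_ _≡_ f → {y : Fin m} → isCycleMin f y ≡ true → IsCycleMin y
  isCycleMin-sound f-inj {y} min k with orbit-bounded f-inj y k
  ... | k′ , k′<m , e = subst (λ z → toℕ y ≤ toℕ z) (sym e) (subst (λ j → toℕ y ≤ toℕ (iter f j y)) (FinP.toℕ-fromℕ< k′<m)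
          (≤ᵇ-true⁻¹ (allB-sound _ min (∈-allFin (fromℕ< k′<m)))))

module _ {n : ℕ} {τ : Fin n → Fin n} (τ-inj : Injective _≡_ _≡_ τ) (j : Fin (suc n)) where

  private
    σ = insert τ j
    σ-inj = insert-injective τ-inj j

    step : ∀ y → inject₁ y ≢ j → σ (inject₁ y) ≡ inject₁ (τ y)
    step y = insert-inject₁ τ

    detour : ∀ y → inject₁ y ≡ j → σ (σ (inject₁ y)) ≡ inject₁ (τ y)
    detour y refl = trans (cong σ (insert-at τ (inject₁ y))) (trans (insert-top τ (inject₁ y)) (extend-inject₁ τ y))

  orbit-lift : (x : Fin n) (k′ : ℕ) → ∃ λ k → iter σ k (inject₁ x) ≡ inject₁ (iter τ k′ x)
  orbit-lift x zero = 0 , refl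
  orbit-lift x (suc k′) with orbit-lift x k′
  ... | k , e with inject₁ (iter τ k′ x) ≟ j
  ...   | no  y≢j = suc k , trans (cong σ e) (step _ y≢j)
  ...   | yes y≡j = suc (suc k) , trans (cong (σ ∘ σ) e) (detour _ y≡j)

  orbit-drop : (x : Fin n) (k : ℕ) → (∃ λ k′ → iter σ k (inject₁ x) ≡ inject₁ (iter τ k′ x))
                                   ⊎ (iter σ k (inject₁ x) ≡ fromℕ n × ∃ λ k′ → inject₁ (iter τ k′ x) ≡ j)
  orbit-drop x zero = inj₁ (0 , refl)
  orbit-drop x (suc k) with orbit-drop x k
  ... | inj₂ (e , k′ , y≡j) = inj₁ (suc k′ , trans (cong σ e) (trans (insert-top τ j) (trans (cong (extend τ) (sym y≡j)) (extend-inject₁ τ _))))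
  ... | inj₁ (k′ , e) with inject₁ (iter τ k′ x) ≟ j
  ...   | no  y≢j = inj₁ (suc k′ , trans (cong σ e) (step _ y≢j))
  ...   | yes y≡j = inj₂ (trans (cong σ (trans e y≡j)) (insert-at τ j) , k′ , y≡j)

  isCycleMin-insert-inject₁ : (x : Fin n) → isCycleMin σ (inject₁ x) ≡ isCycleMin τ x
  isCycleMin-insert-inject₁ x = bool-ext
    (λ min → isCycleMin-complete τ (from-σ (isCycleMin-sound σ σ-inj min)))
    (λ min → isCycleMin-complete σ (to-σ (isCycleMin-sound τ τ-inj min)))
    where
    from-σ : IsCycleMin σ (inject₁ x) → IsCycleMin τ x
    from-σ min k′ with orbit-lift x k′
    ... | k , e = subst₂ _≤_ (FinP.toℕ-inject₁ x) (trans (cong toℕ e) (FinP.toℕ-inject₁ _)) (min k)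
    to-σ : IsCycleMin τ x → IsCycleMin σ (inject₁ x)
    to-σ min k with orbit-drop x k
    ... | inj₁ (k′ , e)  = subst₂ _≤_ (sym (FinP.toℕ-inject₁ x)) (sym (trans (cong toℕ e) (FinP.toℕ-inject₁ _))) (min k′)
    ... | inj₂ (e , _)   = subst₂ _≤_ (sym (FinP.toℕ-inject₁ x)) (sym (trans (cong toℕ e) (FinP.toℕ-fromℕ n))) (ℕP.<⇒≤ (FinP.toℕ<n x))

  cyc-insert : cyc′ σ ≡ cyc′ τ ℕ.+ 𝟙ℕ (isCycleMin σ (fromℕ n))
  cyc-insert = count-lift _ (isCycleMin τ) isCycleMin-insert-inject₁

module _ {n : ℕ} {τ : Fin n → Fin n} (τ-inj : Injective _≡_ _≡_ τ) where

  cyc-insert-top : cyc′ (insert τ (fromℕ n)) ≡ suc (cyc′ τ)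
  cyc-insert-top = trans (cyc-insert τ-inj (fromℕ n)) (trans (cong (λ b → cyc′ τ ℕ.+ 𝟙ℕ b) top-min) (ℕP.+-comm (cyc′ τ) 1))
    where
    fixed : ∀ k → iter (insert τ (fromℕ n)) k (fromℕ n) ≡ fromℕ n
    fixed zero    = refl
    fixed (suc k) = trans (cong (insert τ (fromℕ n)) (fixed k)) (insert-at τ (fromℕ n))
    top-min : isCycleMin (insert τ (fromℕ n)) (fromℕ n) ≡ true
    top-min = isCycleMin-complete _ (λ k → ℕP.≤-reflexive (cong toℕ (sym (fixed k))))

  cyc-insert-inject₁ : (k : Fin n) → cyc′ (insert τ (inject₁ k)) ≡ cyc′ τ
  cyc-insert-inject₁ k = trans (cyc-insert τ-inj (inject₁ k)) (trans (cong (λ b → cyc′ τ ℕ.+ 𝟙ℕ b) top-not-min) (ℕP.+-identityʳ (cyc′ τ)))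
    where
    σ = insert τ (inject₁ k)
    σ-top : toℕ (σ (fromℕ n)) < toℕ (fromℕ n)
    σ-top = subst₂ _<_ (sym (trans (cong toℕ (trans (insert-top τ (inject₁ k)) (extend-inject₁ τ k))) (FinP.toℕ-inject₁ (τ k))))
                       (sym (FinP.toℕ-fromℕ n)) (FinP.toℕ<n (τ k))
    top-not-min : isCycleMin σ (fromℕ n) ≡ false
    top-not-min with isCycleMin σ (fromℕ n) in min
    ... | false = refl
    ... | true  = contradiction (isCycleMin-sound σ (insert-injective τ-inj (inject₁ k)) min 1) (ℕP.<⇒≱ σ-top)

sgn : ℕ → ℤ
sgn k = (- + 1) ^ k

-- q^E t^F (-1)^C as an array of coefficients, indexed by the exponents e of q
-- and f of t.
monomial : (E F C e f : ℕ) → ℤ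
monomial E F C e f = 𝟙 (e ℕ.≡ᵇ E) * 𝟙 (f ℕ.≡ᵇ F) * sgn C

monomial-cong : {E E′ F F′ C C′ : ℕ} → E ≡ E′ → F ≡ F′ → C ≡ C′ → (e f : ℕ) → monomial E F C e f ≡ monomial E′ F′ C′ e f
monomial-cong refl refl refl e f = refl

weight : {n : ℕ} → ℕ → ℕ → (Fin n → Fin n) → ℤ
weight e f σ = monomial (exc′ σ) (fix′ σ) (cyc′ σ) e f

monomial-subst : (h : ℕ → ℕ → ℤ) (E F C e f : ℕ) → h E F * monomial E F C e f ≡ h e f * monomial E F C e f
monomial-subst h E F C e f with e ℕ.≡ᵇ E in e≡E | f ℕ.≡ᵇ F in f≡F
... | true  | true  = cong (_* (+ 1 * + 1 * sgn C)) (cong₂ h (sym (≡ᵇ-true⁻¹ e≡E)) (sym (≡ᵇ-true⁻¹ f≡F)))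
... | true  | false = trans (ℤP.*-zeroʳ (h E F)) (sym (ℤP.*-zeroʳ (h e f)))
... | false | _     = trans (ℤP.*-zeroʳ (h E F)) (sym (ℤP.*-zeroʳ (h e f)))

coeff : (n e f : ℕ) → ℤ
coeff n e f = sumPerm n (weight e f)

-- Inserting the top element into a permutation of Fin n with e excedances
-- and f fixed points makes it a new fixed point (f ↦ f + 1, one more cycle)
-- or puts it after an excedance (no change), after a fixed point
-- (e ↦ e + 1, f ↦ f - 1) or after one of the n - e - f other points (e ↦ e + 1).
newFixed : (ℕ → ℕ → ℤ) → ℕ → ℕ → ℤ
newFixed M e zero    = + 0
newFixed M e (suc f) = - M e f

afterNonExcedance : ℕ → (ℕ → ℕ → ℤ) → ℕ → ℕ → ℤ
afterNonExcedance n M zero    f = + 0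
afterNonExcedance n M (suc e) f = + suc f * M e (suc f) + + (n ∸ e ∸ f) * M e f

insertionStep : ℕ → (ℕ → ℕ → ℤ) → ℕ → ℕ → ℤ
insertionStep n M e f = newFixed M e f + + e * M e f + afterNonExcedance n M e f

insertionStep-cong : (n : ℕ) {M M′ : ℕ → ℕ → ℤ} → (∀ a b → M a b ≡ M′ a b) → (e f : ℕ) → insertionStep n M e f ≡ insertionStep n M′ e f
insertionStep-cong n M≡M′ e f = cong₂ _+_ (cong₂ _+_ (new-fixed f) (cong (+ e *_) (M≡M′ e f))) (after e)
  where
  new-fixed : ∀ f → newFixed _ e f ≡ newFixed _ e f
  new-fixed zero    = refl
  new-fixed (suc f) = cong -_ (M≡M′ e f)
  after : ∀ e → afterNonExcedance n _ e f ≡ afterNonExcedance n _ e f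
  after zero    = refl
  after (suc e) = cong₂ _+_ (cong (+ suc f *_) (M≡M′ e (suc f))) (cong (+ (n ∸ e ∸ f) *_) (M≡M′ e f))

insertionStep-sumPerm : (m n : ℕ) (M : (Fin m → Fin m) → ℕ → ℕ → ℤ) (e f : ℕ) →
                        sumPerm m (λ τ → insertionStep n (M τ) e f) ≡ insertionStep n (λ a b → sumPerm m (λ τ → M τ a b)) e f
insertionStep-sumPerm m n M e f = begin
  sumPerm m (λ τ → newFixed (M τ) e f + + e * M τ e f + afterNonExcedance n (M τ) e f)
    ≡⟨ sumPerm-+ m _ _ ⟩
  sumPerm m (λ τ → newFixed (M τ) e f + + e * M τ e f) + sumPerm m (λ τ → afterNonExcedance n (M τ) e f)
    ≡⟨ cong₂ _+_ (trans (sumPerm-+ m _ _) (cong₂ _+_ (new-fixed f) (sumPerm-*ˡ m (+ e) _))) (after e) ⟩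
  insertionStep n (λ a b → sumPerm m (λ τ → M τ a b)) e f ∎
  where
  open ≡-Reasoning
  new-fixed : ∀ f → sumPerm m (λ τ → newFixed (M τ) e f) ≡ newFixed (λ a b → sumPerm m (λ τ → M τ a b)) e f
  new-fixed zero    = sumPerm-zero m
  new-fixed (suc f) = sumPerm-neg m (λ τ → M τ e f)
  after : ∀ e → sumPerm m (λ τ → afterNonExcedance n (M τ) e f) ≡ afterNonExcedance n (λ a b → sumPerm m (λ τ → M τ a b)) e f
  after zero    = sumPerm-zero m
  after (suc e) = trans (sumPerm-+ m _ _) (cong₂ _+_ (sumPerm-*ˡ m (+ suc f) _) (sumPerm-*ˡ m (+ (n ∸ e ∸ f)) _))

insertionStep-monomial : (n E F C e f : ℕ) →
  insertionStep n (monomial E F C) e f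
    ≡ monomial E (suc F) (suc C) e f + + E * monomial E F C e f
      + (+ F * monomial (suc E) F C e (suc f) + + (n ∸ E ∸ F) * monomial (suc E) F C e f)
insertionStep-monomial n E F C e f = cong₂ _+_ (cong₂ _+_ (new-fixed f) (sym (monomial-subst (λ a _ → + a) E F C e f))) (after e)
  where
  new-fixed : ∀ f → newFixed (monomial E F C) e f ≡ monomial E (suc F) (suc C) e f
  new-fixed zero    = sym (trans (cong (_* sgn (suc C)) (ℤP.*-zeroʳ (𝟙 (e ℕ.≡ᵇ E)))) (ℤP.*-zeroˡ (sgn (suc C))))
  new-fixed (suc f) = solve 3 (λ a b s → :- (a :* b :* s) := a :* b :* (con (- + 1) :* s)) refl (𝟙 (e ℕ.≡ᵇ E)) (𝟙 (f ℕ.≡ᵇ F)) (sgn C)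
  after : ∀ e → afterNonExcedance n (monomial E F C) e f
                ≡ + F * monomial (suc E) F C e (suc f) + + (n ∸ E ∸ F) * monomial (suc E) F C e f
  after zero    = sym (cong₂ _+_ (ℤP.*-zeroʳ (+ F)) (ℤP.*-zeroʳ (+ (n ∸ E ∸ F))))
  after (suc e) = sym (cong₂ _+_ (monomial-subst (λ _ b → + b) E F C e (suc f)) (monomial-subst (λ a b → + (n ∸ a ∸ b)) E F C e f))

module _ {n : ℕ} {τ : Fin n → Fin n} (τ-inj : Injective _≡_ _≡_ τ) (e f : ℕ) where

  private
    E = exc′ τ
    F = fix′ τ
    C = cyc′ τ
    afterExc afterFix afterDef : ℤ
    afterExc = monomial E F C e f
    afterFix = monomial (suc E) F C e (suc f)
    afterDef = monomial (suc E) F C e f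

    mix : Bool → Bool → Bool → ℤ
    mix a b c = 𝟙 a * afterExc + 𝟙 b * afterFix + 𝟙 c * afterDef

    mix-cong : ∀ {a a′ b b′ c c′} → a ≡ a′ → b ≡ b′ → c ≡ c′ → mix a b c ≡ mix a′ b′ c′
    mix-cong refl refl refl = refl

    exc-after : ∀ k {b} → isExc τ k ≡ b → exc′ (insert τ (inject₁ k)) ℕ.+ 𝟙ℕ b ≡ suc E
    exc-after k refl = exc-insert-inject₁ τ k

    fix-after : ∀ k {b} → isFix τ k ≡ b → fix′ (insert τ (inject₁ k)) ℕ.+ 𝟙ℕ b ≡ F
    fix-after k refl = fix-insert-inject₁ τ k

  weight-insert-top : weight e f (insert τ (fromℕ n)) ≡ monomial E (suc F) (suc C) e f
  weight-insert-top = monomial-cong (exc-insert-top τ) (fix-insert-top τ) (cyc-insert-top τ-inj) e f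

  weight-insert-inject₁ : (k : Fin n) → weight e f (insert τ (inject₁ k)) ≡ mix (isExc τ k) (isFix τ k) (isDeficiency τ k)
  weight-insert-inject₁ k with kind τ k
  ... | excedance pe pf pd = begin
    weight e f σ          ≡⟨ monomial-cong exc-same fix-same cyc-same e f ⟩
    afterExc              ≡⟨ solve 3 (λ a b c → a := con (+ 1) :* a :+ con (+ 0) :* b :+ con (+ 0) :* c) refl afterExc afterFix afterDef ⟩
    mix true false false  ≡⟨ mix-cong (sym pe) (sym pf) (sym pd) ⟩
    mix (isExc τ k) (isFix τ k) (isDeficiency τ k) ∎
    where
    open ≡-Reasoning
    σ = insert τ (inject₁ k)
    exc-same = ℕP.suc-injective (trans (ℕP.+-comm 1 (exc′ σ)) (exc-after k pe))
    fix-same = trans (sym (ℕP.+-identityʳ (fix′ σ))) (fix-after k pf)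
    cyc-same = cyc-insert-inject₁ τ-inj k
  ... | fixedPoint pe pf pd = begin
    weight e f σ          ≡⟨ monomial-cong exc-up refl cyc-same e f ⟩
    monomial (suc E) (fix′ σ) C e f
                          ≡⟨ monomial-cong {suc E} {suc E} {suc (fix′ σ)} {F} {C} {C} refl fix-down refl e (suc f) ⟩
    afterFix              ≡⟨ solve 3 (λ a b c → b := con (+ 0) :* a :+ con (+ 1) :* b :+ con (+ 0) :* c) refl afterExc afterFix afterDef ⟩
    mix false true false  ≡⟨ mix-cong (sym pe) (sym pf) (sym pd) ⟩
    mix (isExc τ k) (isFix τ k) (isDeficiency τ k) ∎
    where
    open ≡-Reasoning
    σ = insert τ (inject₁ k)
    exc-up = trans (sym (ℕP.+-identityʳ (exc′ σ))) (exc-after k pe)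
    fix-down = trans (ℕP.+-comm 1 (fix′ σ)) (fix-after k pf)
    cyc-same = cyc-insert-inject₁ τ-inj k
  ... | deficiency pe pf pd = begin
    weight e f σ          ≡⟨ monomial-cong exc-up fix-same cyc-same e f ⟩
    afterDef              ≡⟨ solve 3 (λ a b c → c := con (+ 0) :* a :+ con (+ 0) :* b :+ con (+ 1) :* c) refl afterExc afterFix afterDef ⟩
    mix false false true  ≡⟨ mix-cong (sym pe) (sym pf) (sym pd) ⟩
    mix (isExc τ k) (isFix τ k) (isDeficiency τ k) ∎
    where
    open ≡-Reasoning
    σ = insert τ (inject₁ k)
    exc-up = trans (sym (ℕP.+-identityʳ (exc′ σ))) (exc-after k pe)
    fix-same = trans (sym (ℕP.+-identityʳ (fix′ σ))) (fix-after k pf)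
    cyc-same = cyc-insert-inject₁ τ-inj k

  private
    one-kind : ∀ k → 𝟙ℕ (isExc τ k) ℕ.+ 𝟙ℕ (isFix τ k) ℕ.+ 𝟙ℕ (isDeficiency τ k) ≡ 1
    one-kind k with kind τ k
    ... | excedance  pe pf pd rewrite pe | pf | pd = refl
    ... | fixedPoint pe pf pd rewrite pe | pf | pd = refl
    ... | deficiency pe pf pd rewrite pe | pf | pd = refl

    #def : count (isDeficiency τ) ≡ n ∸ E ∸ F
    #def = begin
      count (isDeficiency τ)
        ≡⟨ ℕP.m+n∸m≡n (E ℕ.+ F) (count (isDeficiency τ)) ⟨
      E ℕ.+ F ℕ.+ count (isDeficiency τ) ∸ (E ℕ.+ F)
        ≡⟨ cong (_∸ (E ℕ.+ F)) (count-partition (isExc τ) (isFix τ) (isDeficiency τ) one-kind) ⟩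
      n ∸ (E ℕ.+ F)
        ≡⟨ ℕP.∸-+-assoc n E F ⟨
      n ∸ E ∸ F ∎
      where open ≡-Reasoning

  insert-weights : ∑[ j < suc n ] weight e f (insert τ j) ≡ insertionStep n (monomial E F C) e f
  insert-weights = begin
    ∑[ j < suc n ] weight e f (insert τ j)
      ≡⟨ sum-init-last {n} (λ j → weight e f (insert τ j)) ⟩
    ∑[ k < n ] weight e f (insert τ (inject₁ k)) + weight e f (insert τ (fromℕ n))
      ≡⟨ cong₂ _+_ (sum-cong-≗ {n} weight-insert-inject₁) weight-insert-top ⟩
    ∑[ k < n ] mix (isExc τ k) (isFix τ k) (isDeficiency τ k) + new
      ≡⟨ cong (_+ new) (trans (∑-distrib-+ (λ k → 𝟙 (isExc τ k) * afterExc + 𝟙 (isFix τ k) * afterFix) (λ k → 𝟙 (isDeficiency τ k) * afterDef))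
                              (cong₂ _+_ (trans (∑-distrib-+ (λ k → 𝟙 (isExc τ k) * afterExc) (λ k → 𝟙 (isFix τ k) * afterFix))
                                                (cong₂ _+_ (∑-𝟙* (isExc τ) afterExc) (∑-𝟙* (isFix τ) afterFix)))
                                         (trans (∑-𝟙* (isDeficiency τ) afterDef) (cong (λ d → + d * afterDef) #def)))) ⟩
    + E * afterExc + + F * afterFix + + (n ∸ E ∸ F) * afterDef + new
      ≡⟨ solve 4 (λ a b c d → a :+ b :+ c :+ d := d :+ a :+ (b :+ c)) refl (+ E * afterExc) (+ F * afterFix) (+ (n ∸ E ∸ F) * afterDef) new ⟩
    new + + E * afterExc + (+ F * afterFix + + (n ∸ E ∸ F) * afterDef)
      ≡⟨ insertionStep-monomial n E F C e f ⟨
    insertionStep n (monomial E F C) e f ∎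
    where
    open ≡-Reasoning
    new = monomial E (suc F) (suc C) e f

coeff-insertionStep : (n e f : ℕ) → coeff (suc n) e f ≡ insertionStep n (coeff n) e f
coeff-insertionStep n e f = begin
  sumPerm (suc n) (weight e f)
    ≡⟨ sumPerm-insert n (weight e f) (λ σ≗σ′ → monomial-cong (exc′-cong σ≗σ′) (fix′-cong σ≗σ′) (cyc′-cong σ≗σ′) e f) ⟩
  sumPerm n (λ τ → ∑[ j < suc n ] weight e f (insert τ j))
    ≡⟨ sumPerm-cong n (λ τ perm → insert-weights (isPerm⇒injective τ perm) e f) ⟩
  sumPerm n (λ τ → insertionStep n (monomial (exc′ τ) (fix′ τ) (cyc′ τ)) e f)
    ≡⟨ insertionStep-sumPerm n n (λ τ → monomial (exc′ τ) (fix′ τ) (cyc′ τ)) e f ⟩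
  insertionStep n (coeff n) e f ∎
  where open ≡-Reasoning

-- (-1)^f (n choose f)
signedBinomial : ℕ → ℕ → ℤ
signedBinomial n       zero    = + 1
signedBinomial zero    (suc f) = + 0
signedBinomial (suc n) (suc f) = signedBinomial n (suc f) - signedBinomial n f

-- The coefficient of q^e in -q [m-1]_q (for m ≥ 1), i.e. in Pₛ m q 0 (-1).
derangementCoeff : ℕ → ℕ → ℤ
derangementCoeff zero    e       = 𝟙 (e ℕ.≡ᵇ 0)
derangementCoeff (suc m) zero    = + 0
derangementCoeff (suc m) (suc e) = - 𝟙 (e <ᵇ m)

signedBinomial-vanish : {n f : ℕ} → n < f → signedBinomial n f ≡ + 0
signedBinomial-vanish {zero}  {suc f} _ = refl
signedBinomial-vanish {suc n} {suc f} (s≤s n<f)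
  rewrite signedBinomial-vanish (ℕP.m<n⇒m<1+n n<f) | signedBinomial-vanish n<f = refl

signedBinomial-shift : (g : ℕ → ℤ) (n f : ℕ) →
                       signedBinomial n (suc f) * g (n ∸ f) ≡ signedBinomial n (suc f) * g (suc (n ∸ suc f))
signedBinomial-shift g n f with f ℕP.<? n
... | yes f<n = cong (λ k → signedBinomial n (suc f) * g k) (ℕP.+-∸-assoc 1 f<n)
... | no  f≮n rewrite signedBinomial-vanish (s≤s (ℕP.≮⇒≥ f≮n)) = refl

signedBinomial-absorb : (n f : ℕ) → + suc f * signedBinomial n (suc f) ≡ - (+ (n ∸ f) * signedBinomial n f)
signedBinomial-absorb zero    f       rewrite ℕP.0∸n≡0 f = ℤP.*-zeroʳ (+ suc f)
signedBinomial-absorb (suc n) zero    = begin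
  + 1 * (K1 - + 1)
    ≡⟨ cong (λ x → + 1 * (x - + 1)) (trans (sym (ℤP.*-identityˡ K1)) (signedBinomial-absorb n 0)) ⟩
  + 1 * (- (+ n * + 1) - + 1)
    ≡⟨ solve 1 (λ x → con (+ 1) :* (:- (x :* con (+ 1)) :- con (+ 1)) := :- ((con (+ 1) :+ x) :* con (+ 1))) refl (+ n) ⟩
  - ((+ 1 + + n) * + 1) ∎
  where
  open ≡-Reasoning
  K1 = signedBinomial n 1
signedBinomial-absorb (suc n) (suc f) = sym (begin
  - (+ (n ∸ f) * (K1 - K0))
    ≡⟨ solve 3 (λ a x y → :- (a :* (x :- y)) := :- (x :* a) :+ a :* y) refl (+ (n ∸ f)) K1 K0 ⟩
  - (K1 * + (n ∸ f)) + + (n ∸ f) * K0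
    ≡⟨ cong₂ (λ x y → - x + y) (signedBinomial-shift +_ n f) (sym (trans (cong -_ (signedBinomial-absorb n f)) (ℤP.neg-involutive _))) ⟩
  - (K1 * + suc (n ∸ suc f)) + - (+ suc f * K1)
    ≡⟨ cong (λ x → - (K1 * x) + - (+ suc f * K1)) (ℤP.pos-+ 1 (n ∸ suc f)) ⟩
  - (K1 * (+ 1 + + (n ∸ suc f))) + - (+ suc f * K1)
    ≡⟨ solve 3 (λ x d s → :- (x :* (con (+ 1) :+ d)) :+ :- (s :* x) := :- (d :* x) :- (con (+ 1) :+ s) :* x) refl K1 (+ (n ∸ suc f)) (+ suc f) ⟩
  - (+ (n ∸ suc f) * K1) - (+ 1 + + suc f) * K1
    ≡⟨ cong₂ _-_ (sym (signedBinomial-absorb n (suc f))) (cong (_* K1) (sym (ℤP.pos-+ 1 (suc f)))) ⟩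
  + suc (suc f) * K2 - + suc (suc f) * K1
    ≡⟨ solve 3 (λ a x y → a :* x :- a :* y := a :* (x :- y)) refl (+ suc (suc f)) K2 K1 ⟩
  + suc (suc f) * (K2 - K1) ∎)
  where
  open ≡-Reasoning
  K2 = signedBinomial n (suc (suc f))
  K1 = signedBinomial n (suc f)
  K0 = signedBinomial n f

derangementCoeff-step : (m e : ℕ) →
  derangementCoeff (suc m) (suc e)
    ≡ + suc e * derangementCoeff m (suc e) + + (m ∸ e) * derangementCoeff m e - + m * derangementCoeff (pred m) e
derangementCoeff-step zero e rewrite ℕP.0∸n≡0 e | ℤP.*-zeroʳ (+ suc e) = refl
derangementCoeff-step (suc zero)     zero = refl
derangementCoeff-step (suc (suc m))  zero rewrite ℤP.*-zeroʳ (+ suc (suc m)) = refl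
derangementCoeff-step (suc zero)     (suc e) rewrite ℤP.*-zeroʳ (+ suc (suc e)) | ℤP.*-zeroʳ (+ (0 ∸ e)) = refl
derangementCoeff-step (suc (suc m))  (suc e) with e ℕP.≤? m
... | no e≰m rewrite <ᵇ-false (ℕP.≰⇒≥ e≰m) | <ᵇ-false (ℕP.≰⇒> e≰m)
                   | ℤP.*-zeroʳ (+ suc (suc e)) | ℤP.*-zeroʳ (+ (suc m ∸ e)) | ℤP.*-zeroʳ (+ suc (suc m)) = refl
... | yes e≤m with ℕP.m≤n⇒∃[o]m+o≡n e≤m
...   | d , refl rewrite <ᵇ-true (s≤s (ℕP.m≤m+n e d)) | ℕP.+-∸-assoc 1 (ℕP.m≤m+n e d) | ℕP.m+n∸m≡n e d = gap d
  where
  gap : ∀ d → - + 1 ≡ + suc (suc e) * - 𝟙 (e <ᵇ e ℕ.+ d) + + suc d * - + 1 - + suc (suc (e ℕ.+ d)) * - 𝟙 (e <ᵇ e ℕ.+ d)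
  gap zero    rewrite ℕP.+-identityʳ e | <ᵇ-false (ℕP.≤-refl {e}) | ℤP.*-zeroʳ (+ suc (suc e)) = refl
  gap (suc d) rewrite <ᵇ-true (ℕP.m<m+n e {suc d} (s≤s z≤n)) | ℤP.pos-+ 2 e | ℤP.pos-+ 2 d | ℤP.pos-+ 2 (e ℕ.+ suc d) | ℤP.pos-+ e (suc d) | ℤP.pos-+ 1 d =
    solve 2 (λ x y → :- con (+ 1) := (con (+ 2) :+ x) :* :- con (+ 1) :+ (con (+ 1) :+ (con (+ 1) :+ y)) :* :- con (+ 1)
                                     :- (con (+ 2) :+ (x :+ (con (+ 1) :+ y))) :* :- con (+ 1))
            refl (+ e) (+ d)

-- Choose the f fixed points and derange the other n - f points.
closedForm : (n e f : ℕ) → ℤ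
closedForm n e f = signedBinomial n f * derangementCoeff (n ∸ f) e

closedForm-insertions : (n e f : ℕ) →
  + suc e * closedForm n (suc e) f + afterNonExcedance n (closedForm n) (suc e) f
    ≡ signedBinomial n f * derangementCoeff (suc (n ∸ f)) (suc e)
closedForm-insertions n e f = begin
  + suc e * (K0 * D m (suc e)) + (+ suc f * (K1 * D (n ∸ suc f) e) + + (n ∸ e ∸ f) * (K0 * D m e))
    ≡⟨ cong₂ (λ x y → + suc e * (K0 * D m (suc e)) + (+ suc f * (K1 * D x e) + + y * (K0 * D m e))) m-1 m-e ⟩
  + suc e * (K0 * D m (suc e)) + (+ suc f * (K1 * D (pred m) e) + + (m ∸ e) * (K0 * D m e))
    ≡⟨ cong (λ x → + suc e * (K0 * D m (suc e)) + (x + + (m ∸ e) * (K0 * D m e)))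
            (trans (sym (ℤP.*-assoc (+ suc f) K1 _)) (cong (_* D (pred m) e) (signedBinomial-absorb n f))) ⟩
  + suc e * (K0 * D m (suc e)) + (- (+ m * K0) * D (pred m) e + + (m ∸ e) * (K0 * D m e))
    ≡⟨ solve 7 (λ k s a b c x y → s :* (k :* a) :+ (:- (y :* k) :* c :+ x :* (k :* b)) := k :* (s :* a :+ x :* b :- y :* c))
             refl K0 (+ suc e) (D m (suc e)) (D m e) (D (pred m) e) (+ (m ∸ e)) (+ m) ⟩
  K0 * (+ suc e * D m (suc e) + + (m ∸ e) * D m e - + m * D (pred m) e)
    ≡⟨ cong (K0 *_) (derangementCoeff-step m e) ⟨
  K0 * D (suc m) (suc e) ∎
  where
  open ≡-Reasoning
  D = derangementCoeff
  K0 = signedBinomial n f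
  K1 = signedBinomial n (suc f)
  m = n ∸ f
  m-1 : n ∸ suc f ≡ pred m
  m-1 = sym (ℕP.pred[m∸n]≡m∸[1+n] n f)
  m-e : n ∸ e ∸ f ≡ m ∸ e
  m-e = trans (ℕP.∸-+-assoc n e f) (trans (cong (n ∸_) (ℕP.+-comm e f)) (sym (ℕP.∸-+-assoc n f e)))

closedForm-step : (n e f : ℕ) → closedForm (suc n) e f ≡ insertionStep n (closedForm n) e f
closedForm-step n zero zero = refl
closedForm-step n zero (suc f) = begin
  (K1 - K0) * D (n ∸ f) 0
    ≡⟨ ℤP.*-distribʳ-+ (D (n ∸ f) 0) K1 (- K0) ⟩
  K1 * D (n ∸ f) 0 + - K0 * D (n ∸ f) 0
    ≡⟨ cong₂ _+_ (trans (signedBinomial-shift (λ k → D k 0) n f) (ℤP.*-zeroʳ K1)) (sym (ℤP.neg-distribˡ-* K0 _)) ⟩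
  + 0 + - (K0 * D (n ∸ f) 0)
    ≡⟨ solve 1 (λ x → con (+ 0) :+ :- x := :- x :+ con (+ 0) :+ con (+ 0)) refl (K0 * D (n ∸ f) 0) ⟩
  - (K0 * D (n ∸ f) 0) + + 0 + + 0 ∎
  where
  open ≡-Reasoning
  D = derangementCoeff
  K0 = signedBinomial n f
  K1 = signedBinomial n (suc f)
closedForm-step n (suc e) zero = begin
  + 1 * D (suc n) (suc e)                 ≡⟨ closedForm-insertions n e 0 ⟨
  X + Y                                   ≡⟨ cong (_+ Y) (ℤP.+-identityˡ X) ⟨
  + 0 + X + Y                             ∎
  where
  open ≡-Reasoning
  D = derangementCoeff
  X = + suc e * closedForm n (suc e) 0
  Y = afterNonExcedance n (closedForm n) (suc e) 0
closedForm-step n (suc e) (suc f) = begin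
  (K1 - K0) * D (n ∸ f) (suc e)
    ≡⟨ solve 3 (λ a b d → (a :- b) :* d := :- (b :* d) :+ a :* d) refl K1 K0 (D (n ∸ f) (suc e)) ⟩
  - (K0 * D (n ∸ f) (suc e)) + K1 * D (n ∸ f) (suc e)
    ≡⟨ cong (_+_ (- (K0 * D (n ∸ f) (suc e)))) (trans (signedBinomial-shift (λ k → D k (suc e)) n f) (sym (closedForm-insertions n e (suc f)))) ⟩
  - (K0 * D (n ∸ f) (suc e)) + (X + Y)
    ≡⟨ ℤP.+-assoc (- (K0 * D (n ∸ f) (suc e))) X Y ⟨
  - (K0 * D (n ∸ f) (suc e)) + X + Y ∎
  where
  open ≡-Reasoning
  D = derangementCoeff
  K0 = signedBinomial n f
  K1 = signedBinomial n (suc f)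
  X = + suc e * closedForm n (suc e) (suc f)
  Y = afterNonExcedance n (closedForm n) (suc e) (suc f)

coeff≡closedForm : (n e f : ℕ) → coeff n e f ≡ closedForm n e f
coeff≡closedForm zero e zero    = solve 1 (λ x → x :* con (+ 1) :* con (+ 1) :+ con (+ 0) := con (+ 1) :* x) refl (𝟙 (e ℕ.≡ᵇ 0))
coeff≡closedForm zero e (suc f) = trans (ℤP.+-identityʳ _) (cong (_* + 1) (ℤP.*-zeroʳ (𝟙 (e ℕ.≡ᵇ 0))))
coeff≡closedForm (suc n) e f = begin
  coeff (suc n) e f                  ≡⟨ coeff-insertionStep n e f ⟩
  insertionStep n (coeff n) e f      ≡⟨ insertionStep-cong n (coeff≡closedForm n) e f ⟩
  insertionStep n (closedForm n) e f ≡⟨ closedForm-step n e f ⟨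
  closedForm (suc n) e f             ∎
  where open ≡-Reasoning

0^≡𝟙 : (k : ℕ) → (+ 0) ^ k ≡ 𝟙 (0 ℕ.≡ᵇ k)
0^≡𝟙 zero    = refl
0^≡𝟙 (suc k) = refl

Pₛ-derangements : (n : ℕ) (q : ℤ) → Pₛ n q (+ 0) (- + 1) ≡ ∑[ e < suc n ] (q ^ toℕ e * coeff n (toℕ e) 0)
Pₛ-derangements n q = begin
  sumPerm n (λ τ → q ^ exc′ τ * (+ 0) ^ fix′ τ * sgn (cyc′ τ))
    ≡⟨ sumPerm-cong n (λ τ _ → expand τ) ⟩
  sumPerm n (λ τ → ∑[ e < suc n ] (q ^ toℕ e * weight (toℕ e) 0 τ))
    ≡⟨ sumPerm-∑ n (suc n) (λ τ e → q ^ toℕ e * weight (toℕ e) 0 τ) ⟩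
  ∑[ e < suc n ] sumPerm n (λ τ → q ^ toℕ e * weight (toℕ e) 0 τ)
    ≡⟨ sum-cong-≗ {suc n} (λ e → sumPerm-*ˡ n (q ^ toℕ e) (weight (toℕ e) 0)) ⟩
  ∑[ e < suc n ] (q ^ toℕ e * coeff n (toℕ e) 0) ∎
  where
  open ≡-Reasoning
  expand : ∀ τ → q ^ exc′ τ * (+ 0) ^ fix′ τ * sgn (cyc′ τ) ≡ ∑[ e < suc n ] (q ^ toℕ e * weight (toℕ e) 0 τ)
  expand τ = sym (begin
    ∑[ e < suc n ] (q ^ toℕ e * (𝟙 (toℕ e ℕ.≡ᵇ exc′ τ) * 𝟙 (0 ℕ.≡ᵇ fix′ τ) * sgn (cyc′ τ)))
      ≡⟨ sum-cong-≗ {suc n} (λ e → solve 4 (λ a b c d → a :* (b :* c :* d) := b :* (a :* (c :* d))) refl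
                                  (q ^ toℕ e) (𝟙 (toℕ e ℕ.≡ᵇ exc′ τ)) (𝟙 (0 ℕ.≡ᵇ fix′ τ)) (sgn (cyc′ τ))) ⟩
    ∑[ e < suc n ] (𝟙 (toℕ e ℕ.≡ᵇ exc′ τ) * (q ^ toℕ e * (𝟙 (0 ℕ.≡ᵇ fix′ τ) * sgn (cyc′ τ))))
      ≡⟨ ∑-sift-toℕ (λ e → q ^ e * (𝟙 (0 ℕ.≡ᵇ fix′ τ) * sgn (cyc′ τ))) (s≤s (count≤n (isExc τ))) ⟩
    q ^ exc′ τ * (𝟙 (0 ℕ.≡ᵇ fix′ τ) * sgn (cyc′ τ))
      ≡⟨ ℤP.*-assoc (q ^ exc′ τ) _ _ ⟨
    q ^ exc′ τ * 𝟙 (0 ℕ.≡ᵇ fix′ τ) * sgn (cyc′ τ)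
      ≡⟨ cong (λ z → q ^ exc′ τ * z * sgn (cyc′ τ)) (0^≡𝟙 (fix′ τ)) ⟨
    q ^ exc′ τ * (+ 0) ^ fix′ τ * sgn (cyc′ τ) ∎)

Pₛ-derangements-closed : (m : ℕ) (q : ℤ) → Pₛ (suc m) q (+ 0) (- + 1) ≡ - (q * qint m q)
Pₛ-derangements-closed m q = begin
  Pₛ (suc m) q (+ 0) (- + 1)
    ≡⟨ Pₛ-derangements (suc m) q ⟩
  ∑[ e < suc (suc m) ] (q ^ toℕ e * coeff (suc m) (toℕ e) 0)
    ≡⟨ sum-cong-≗ {suc (suc m)} (λ e → cong (q ^ toℕ e *_) (trans (coeff≡closedForm (suc m) (toℕ e) 0) (ℤP.*-identityˡ _))) ⟩
  q ^ 0 * + 0 + ∑[ e < suc m ] (q ^ suc (toℕ e) * - 𝟙 (toℕ e <ᵇ m))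
    ≡⟨ cong₂ _+_ (ℤP.*-zeroʳ (q ^ 0)) (sum-init-last {m} (λ e → q ^ suc (toℕ e) * - 𝟙 (toℕ e <ᵇ m))) ⟩
  + 0 + (∑[ e < m ] (q ^ suc (toℕ (inject₁ e)) * - 𝟙 (toℕ (inject₁ e) <ᵇ m)) + q ^ suc (toℕ (fromℕ m)) * - 𝟙 (toℕ (fromℕ m) <ᵇ m))
    ≡⟨ trans (ℤP.+-identityˡ _) (cong₂ _+_ (sum-cong-≗ {m} below) last) ⟩
  ∑[ e < m ] (- q * q ^ toℕ e) + + 0
    ≡⟨ trans (ℤP.+-identityʳ _) (sym (*-distribˡ-sum {m} (- q) (λ e → q ^ toℕ e))) ⟩
  - q * ∑[ e < m ] (q ^ toℕ e)
    ≡⟨ cong (- q *_) (geometric m q) ⟩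
  - q * qint m q
    ≡⟨ ℤP.neg-distribˡ-* q (qint m q) ⟨
  - (q * qint m q) ∎
  where
  open ≡-Reasoning
  below : ∀ e → q ^ suc (toℕ (inject₁ e)) * - 𝟙 (toℕ (inject₁ e) <ᵇ m) ≡ - q * q ^ toℕ e
  below e = begin
    q ^ suc (toℕ (inject₁ e)) * - 𝟙 (toℕ (inject₁ e) <ᵇ m)
      ≡⟨ cong (λ k → q ^ suc k * - 𝟙 (k <ᵇ m)) (FinP.toℕ-inject₁ e) ⟩
    q ^ suc (toℕ e) * - 𝟙 (toℕ e <ᵇ m)
      ≡⟨ cong (λ b → q ^ suc (toℕ e) * - 𝟙 b) (<ᵇ-true (FinP.toℕ<n e)) ⟩
    q * q ^ toℕ e * - + 1
      ≡⟨ solve 2 (λ x y → x :* y :* :- con (+ 1) := :- x :* y) refl q (q ^ toℕ e) ⟩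
    - q * q ^ toℕ e ∎
  last : q ^ suc (toℕ (fromℕ m)) * - 𝟙 (toℕ (fromℕ m) <ᵇ m) ≡ + 0
  last rewrite FinP.toℕ-fromℕ m | <ᵇ-false (ℕP.≤-refl {m}) = ℤP.*-zeroʳ (q ^ suc m)

P-derangements : (O : Stat) (r′ m : ℕ) (q : ℤ) →
                 P O (suc r′) (suc m) q (+ 0) (- + 1) ≡ qint (suc r′) q ^ suc m * - (q * qint m q)
P-derangements O r′ m q =
  trans (P≡qint^n*Pₛ O r′ (suc m) q (+ 0) (- + 1)) (cong (qint (suc r′) q ^ suc m *_) (Pₛ-derangements-closed m q))

theorem2 : (r : ℕ) → 1 ≤ r → (n : ℕ) → 2 ≤ n → (q : ℤ) →
    ((O : Stat) →
        P O r n q (+ 0) (- + 1)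
          ≡ qint r q * (P O r (n ∸ 1) q (+ 0) (- + 1) - q ^ (n ∸ 1) * qint r q ^ (n ∸ 1)))
    × (P Abs r n q (+ 0) (- + 1) ≡ P Clr r n q (+ 0) (- + 1))
    × (P Abs r n q (+ 0) (- + 1) ≡ - (q * qint r q ^ n * qint (n ∸ 1) q))
    × (P Clr r n q (+ 0) (- + 1) ≡ - (q * qint r q ^ n * qint (n ∸ 1) q))
theorem2 (suc r′) _ (suc zero) (s≤s ()) q
theorem2 (suc r′) _ (suc (suc m)) _ q =
  recursion , trans (P-derangements Abs r′ (suc m) q) (sym (P-derangements Clr r′ (suc m) q)) , closed Abs , closed Clr
  where
  R = qint (suc r′) q
  recursion : ∀ O → P O (suc r′) (suc (suc m)) q (+ 0) (- + 1) ≡ R * (P O (suc r′) (suc m) q (+ 0) (- + 1) - q ^ suc m * R ^ suc m)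
  recursion O = trans (P-derangements O r′ (suc m) q) (trans
    (solve 5 (λ x u y z w → x :* u :* :- (y :* (z :+ w)) := x :* (u :* :- (y :* z) :- y :* w :* u)) refl R (R ^ suc m) q (qint m q) (q ^ m))
    (cong (λ p → R * (p - q ^ suc m * R ^ suc m)) (sym (P-derangements O r′ m q))))
  closed : ∀ O → P O (suc r′) (suc (suc m)) q (+ 0) (- + 1) ≡ - (q * R ^ suc (suc m) * qint (suc m) q)
  closed O = trans (P-derangements O r′ (suc m) q)
    (solve 3 (λ x y z → x :* :- (y :* z) := :- (y :* x :* z)) refl (R ^ suc (suc m)) q (qint (suc m) q))
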